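{- For every $n\ge 1$ and every deterministic online algorithm $\mathrm{DET}$ for the online multiple knapsack problem with $n$ bins, the competitive ratio of $\mathrm{DET}$ is at most $R - 1/(52n)$, where $R=1/(1+\ln 2)$; i.e., there exists an input sequence $\sigma$ with $\mathrm{OPT}(\sigma)>0$ and $\mathrm{DET}(\sigma) \le (R - 1/(52n))\cdot \mathrm{OPT}(\sigma)$.
   Context: Online multiple knapsack problem (proportional variant): there are $n$ bins, each of capacity $1$. Items with sizes in $(0,1]$ arrive one at a time. Upon arrival of an item, an online algorithm must irrevocably either reject it or place it into one bin so that no bin's total size exceeds $1$, without knowledge of future items. $A(\sigma)$ is the total size of the items accepted by algorithm $A$ on input $\sigma$; $\mathrm{OPT}(\sigma)$ is the maximum total size of a subset of the items of $\sigma$ that can be feasibly packed into the $n$ bins. An algorithm is $\alpha$-competitive if $A(\sigma)\ge \alpha\cdot\mathrm{OPT}(\sigma)$ for every input $\sigma$; its competitive ratio is the supremum of such $\alpha$. -}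

module Defs where

open import Data.Nat as ℕ using (ℕ; zero; suc)
open import Data.Fin using (Fin; _≟_)
open import Data.Maybe using (Maybe; just; nothing)
open import Data.List using (List; []; _∷_; _++_; length; zip)
open import Data.List.Relation.Unary.All using (All)
open import Data.Product using (Σ; ∃; _×_; _,_)
open import Data.Integer using (+_)
open import Data.Rational using (ℚ; 0ℚ; 1ℚ; _+_; _*_; _/_; _≤_; _<_)
open import Relation.Nullary using (yes; no)
open import Relation.Binary.PropositionalEquality using (_≡_)

Decision : ℕ → Set
Decision n = Maybe (Fin n)

Assignment : ℕ → Set
Assignment n = List (ℚ × Decision n)

load : ∀ {n} → Assignment n → Fin n → ℚ
load [] i = 0ℚ
load ((x , nothing) ∷ as) i = load as i
load ((x , just j) ∷ as) i with j ≟ i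
... | yes _ = x + load as i
... | no  _ = load as i

value : ∀ {n} → Assignment n → ℚ
value [] = 0ℚ
value ((x , nothing) ∷ as) = value as
value ((x , just j) ∷ as) = x + value as

Feasible : ∀ {n} → Assignment n → Set
Feasible {n} as = (i : Fin n) → load as i ≤ 1ℚ

ValidInput : List ℚ → Set
ValidInput = All (λ x → (0ℚ < x) × (x ≤ 1ℚ))

-- Deterministic online algorithm with n bins: its decision on the current
-- item is a function of the previously arrived items (in arrival order)
-- and the current item. (Its earlier decisions are determined by the
-- earlier items, so this is the most general deterministic algorithm.)
record OnlineAlg (n : ℕ) : Set where
  field
    decide : List ℚ → ℚ → Decision n

open OnlineAlg public

decisionsFrom : ∀ {n} → OnlineAlg n → List ℚ → List ℚ → List (Decision n)
decisionsFrom A hist [] = []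
decisionsFrom A hist (x ∷ xs) = decide A hist x ∷ decisionsFrom A (hist ++ x ∷ []) xs

decisions : ∀ {n} → OnlineAlg n → List ℚ → List (Decision n)
decisions A σ = decisionsFrom A [] σ

run : ∀ {n} → OnlineAlg n → List ℚ → Assignment n
run A σ = zip σ (decisions A σ)

algValue : ∀ {n} → OnlineAlg n → List ℚ → ℚ
algValue A σ = value (run A σ)

Legal : ∀ {n} → OnlineAlg n → Set
Legal A = ∀ σ → ValidInput σ → Feasible (run A σ)

IsOPT : (n : ℕ) → List ℚ → ℚ → Set
IsOPT n σ v =
  (Σ (List (Decision n)) λ ds → (length ds ≡ length σ) × Feasible (zip σ ds) × (value (zip σ ds) ≡ v))
  × (∀ (ds : List (Decision n)) → length ds ≡ length σ → Feasible (zip σ ds) → value (zip σ ds) ≤ v)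

-- Partial sums S_N = Σ_{k=1}^{N} 1/(k·2^k); these increase to ln 2.
-- (1/2)^k
halfPow : ℕ → ℚ
halfPow zero = 1ℚ
halfPow (suc k) = (+ 1 / 2) * halfPow k

lnTwoPartial : ℕ → ℚ
lnTwoPartial zero = 0ℚ
lnTwoPartial (suc N) = lnTwoPartial N + (+ 1 / suc N) * halfPow (suc N)

-- q < ln 2 (the Dedekind lower cut of ln 2).
BelowLnTwo : ℚ → Set
BelowLnTwo q = ∃ λ N → q < lnTwoPartial N

-- 1/(52n)  (n ≥ 1 in all uses; the value at n = 0 is irrelevant).
eps : ℕ → ℚ
eps zero = 0ℚ
eps (suc m) = + 1 / (52 ℕ.* suc m)

-- d ≤ (R − 1/(52n))·o with R = 1/(1+ln 2), for d, o ≥ 0.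
-- Equivalently (d + o/(52n))·(1 + ln 2) ≤ o, which (as d + o/(52n) ≥ 0)
-- holds iff (d + o/(52n))·(1 + q) ≤ o for every rational q < ln 2.
AtMostRatio : ℕ → ℚ → ℚ → Set
AtMostRatio n d o = ∀ q → BelowLnTwo q → (d + eps n * o) * (1ℚ + q) ≤ o

-- The adversary offers blocks of n equal items of a size s ∈ (½, 1]. No bin holds two items
-- larger than ½, so the optimum of the input so far is n·s. It stops as soon as ALG's total value
-- is at most K·s, where K = (n − 1/25)/(1 + U) for a rational U ≥ ln 2; this gives the ratio.
-- Otherwise ALG has accepted a ≥ 1 further items, and the next size is chosen so that ALG's
-- value is again K·s, i.e. s grows by the factor (K + a)/K. At most n items can ever be
-- accepted, so there are at most n + 1 rounds. The sizes stay below 1: with p = 1/(2s) and F a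
-- partial sum of −ln (1 − y), the potential Γ·F(1 − p) ≈ Γ·ln (2s), Γ = 2K(K + 1), grows by at
-- most 2K + 1 per accepted item (a trapezoid-rule bound for ln ((K + a)/K)), so after at most n
-- acceptances it is still below Γ·F(½) ≈ Γ·ln 2. The first block uses the size (1 + η)/2 with
-- η = 1/(600 n²), just above ½.

{-# OPTIONS --safe #-}
module Submission where

open import Data.Empty using (⊥-elim)
open import Data.Fin using (Fin; zero; suc; _≟_)
import Data.Fin.Properties as Fin
open import Data.Integer as ℤ using (+_)
import Data.Integer.Properties as ℤ
open import Data.List using (List; []; _∷_; _++_; length; zip; replicate; map)
import Data.List.Properties as List
open import Data.List.Relation.Unary.All using (All; []; _∷_)
import Data.List.Relation.Unary.All as All
open import Data.List.Relation.Unary.All.Properties using (++⁺; replicate⁺)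
open import Data.Maybe using (just; nothing)
import Data.Maybe as Maybe
open import Data.Nat as ℕ using (ℕ; zero; suc; _≥_; _≤′_; ≤′-refl; ≤′-step)
import Data.Nat.Properties as ℕ
open import Algebra.Properties.Monoid.Sum ℕ.+-0-monoid using (sum; sum-cong-≗)
open import Data.Nat.Coprimality using (1-coprimeTo)
open import Data.Product using (Σ; _×_; _,_; proj₁; proj₂)
open import Data.Rational hiding (_≟_; _≥_)
open import Data.Rational.Properties hiding (_≟_)
import Data.Rational.Properties as ℚ
import Data.Rational.Unnormalised as ℚᵘ
import Data.Rational.Unnormalised.Properties as ℚᵘ
open import Data.Rational.Solver
open import Data.Sum using (_⊎_; inj₁; inj₂)
open import Function using (_∘_)
open import Relation.Nullary using (yes; no)
open import Relation.Binary.PropositionalEquality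
open import Defs

open +-*-Solver

-- Ordered-field arithmetic on ℚ

0≤+ : ∀ {p q} → 0ℚ ≤ p → 0ℚ ≤ q → 0ℚ ≤ p + q
0≤+ 0≤p 0≤q = +-mono-≤ 0≤p 0≤q

0<+ : ∀ {p q} → 0ℚ < p → 0ℚ ≤ q → 0ℚ < p + q
0<+ 0<p 0≤q = +-mono-<-≤ 0<p 0≤q

0≤* : ∀ {p q} → 0ℚ ≤ p → 0ℚ ≤ q → 0ℚ ≤ p * q
0≤* {p} {q} 0≤p 0≤q = nonNegative⁻¹ _ {{nonNeg*nonNeg⇒nonNeg p {{nonNegative 0≤p}} q {{nonNegative 0≤q}}}}

0<* : ∀ {p q} → 0ℚ < p → 0ℚ < q → 0ℚ < p * q
0<* {p} {q} 0<p 0<q = positive⁻¹ _ {{pos*pos⇒pos p {{positive 0<p}} q {{positive 0<q}}}}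

0≤p*p : ∀ p → 0ℚ ≤ p * p
0≤p*p p with ≤-total 0ℚ p
... | inj₁ 0≤p = 0≤* 0≤p 0≤p
... | inj₂ p≤0 = ≤-trans (0≤* 0≤-p 0≤-p) (≤-reflexive (solve 1 (λ p → (:- p) :* (:- p) := p :* p) refl p))
  where
  0≤-p : 0ℚ ≤ - p
  0≤-p = neg-antimono-≤ p≤0

p≤q⇒0≤q-p : ∀ {p q} → p ≤ q → 0ℚ ≤ q - p
p≤q⇒0≤q-p {p} {q} p≤q = ≤-trans (≤-reflexive (sym (+-inverseʳ p))) (+-monoˡ-≤ (- p) p≤q)

≤-by-gap : ∀ {p q} d → q ≡ p + d → 0ℚ ≤ d → p ≤ q
≤-by-gap {p} {q} d q≡p+d 0≤d = begin
  p       ≡⟨ +-identityʳ p ⟨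
  p + 0ℚ  ≤⟨ +-monoʳ-≤ p 0≤d ⟩
  p + d   ≡⟨ q≡p+d ⟨
  q       ∎
  where open ≤-Reasoning

<-by-gap : ∀ {p q} d → q ≡ p + d → 0ℚ < d → p < q
<-by-gap {p} {q} d q≡p+d 0<d = begin-strict
  p       ≡⟨ +-identityʳ p ⟨
  p + 0ℚ  <⟨ +-monoʳ-< p 0<d ⟩
  p + d   ≡⟨ q≡p+d ⟨
  q       ∎
  where open ≤-Reasoning

0<½ : 0ℚ < ½
0<½ = positive⁻¹ ½

-- As in Data.Nat.Properties, ˡ/ʳ name the argument that varies; the ℚ lemmas
-- *-monoˡ-≤-nonNeg and *-monoʳ-≤-nonNeg use the opposite convention.
*-monoʳ-≤ : ∀ {r p q} → 0ℚ ≤ r → p ≤ q → r * p ≤ r * q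
*-monoʳ-≤ {r} 0≤r = *-monoˡ-≤-nonNeg r {{nonNegative 0≤r}}

*-monoˡ-≤ : ∀ {r p q} → 0ℚ ≤ r → p ≤ q → p * r ≤ q * r
*-monoˡ-≤ {r} 0≤r = *-monoʳ-≤-nonNeg r {{nonNegative 0≤r}}

*-mono-≤ : ∀ {p p′ q q′} → 0ℚ ≤ p → p ≤ p′ → 0ℚ ≤ q → q ≤ q′ → p * q ≤ p′ * q′
*-mono-≤ 0≤p p≤p′ 0≤q q≤q′ = ≤-trans (*-monoˡ-≤ 0≤q p≤p′) (*-monoʳ-≤ (≤-trans 0≤p p≤p′) q≤q′)

*-monoˡ-< : ∀ {r p q} → 0ℚ < r → p < q → p * r < q * r
*-monoˡ-< {r} 0<r = *-monoˡ-<-pos r {{positive 0<r}}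

*-cancelˡ-≤ : ∀ {r p q} → 0ℚ < r → r * p ≤ r * q → p ≤ q
*-cancelˡ-≤ {r} 0<r = *-cancelˡ-≤-pos r {{positive 0<r}}

*-cancelˡ-< : ∀ {r p q} → 0ℚ ≤ r → r * p < r * q → p < q
*-cancelˡ-< {r} 0≤r = *-cancelˡ-<-nonNeg r {{nonNegative 0≤r}}

fromℕ : ℕ → ℚ
fromℕ k = + k / 1

toℚᵘ-/ : ∀ i d → toℚᵘ (i / suc d) ℚᵘ.≃ ℚᵘ.mkℚᵘ i d
toℚᵘ-/ i d = toℚᵘ-fromℚᵘ (ℚᵘ.mkℚᵘ i d)

fromℕ-suc : ∀ k → fromℕ (suc k) ≡ 1ℚ + fromℕ k
fromℕ-suc k = toℚᵘ-injective (begin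
  toℚᵘ (fromℕ (suc k))              ≈⟨ toℚᵘ-/ (+ suc k) 0 ⟩
  ℚᵘ.mkℚᵘ (+ suc k) 0               ≈⟨ ℚᵘ.*≡* (trans (ℤ.*-identityʳ _) (sym (trans (ℤ.*-identityʳ _) (cong (ℤ._+_ (+ 1)) (ℤ.*-identityʳ (+ k)))))) ⟩
  ℚᵘ.1ℚᵘ ℚᵘ.+ ℚᵘ.mkℚᵘ (+ k) 0       ≈⟨ ℚᵘ.+-cong (toℚᵘ-/ (+ 1) 0) (toℚᵘ-/ (+ k) 0) ⟨
  toℚᵘ 1ℚ ℚᵘ.+ toℚᵘ (fromℕ k)       ≈⟨ toℚᵘ-homo-+ 1ℚ (fromℕ k) ⟨
  toℚᵘ (1ℚ + fromℕ k)               ∎)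
  where open ℚᵘ.≃-Reasoning

fromℕ-+ : ∀ a b → fromℕ (a ℕ.+ b) ≡ fromℕ a + fromℕ b
fromℕ-+ zero    b = sym (+-identityˡ (fromℕ b))
fromℕ-+ (suc a) b = begin
  fromℕ (suc (a ℕ.+ b))       ≡⟨ fromℕ-suc (a ℕ.+ b) ⟩
  1ℚ + fromℕ (a ℕ.+ b)        ≡⟨ cong (_+_ 1ℚ) (fromℕ-+ a b) ⟩
  1ℚ + (fromℕ a + fromℕ b)    ≡⟨ +-assoc 1ℚ (fromℕ a) (fromℕ b) ⟨
  (1ℚ + fromℕ a) + fromℕ b    ≡⟨ cong (_+ fromℕ b) (fromℕ-suc a) ⟨
  fromℕ (suc a) + fromℕ b     ∎
  where open ≡-Reasoning

fromℕ-* : ∀ a b → fromℕ (a ℕ.* b) ≡ fromℕ a * fromℕ b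
fromℕ-* zero    b = sym (*-zeroˡ (fromℕ b))
fromℕ-* (suc a) b = begin
  fromℕ (b ℕ.+ a ℕ.* b)        ≡⟨ fromℕ-+ b (a ℕ.* b) ⟩
  fromℕ b + fromℕ (a ℕ.* b)    ≡⟨ cong (_+_ (fromℕ b)) (fromℕ-* a b) ⟩
  fromℕ b + fromℕ a * fromℕ b  ≡⟨ solve 2 (λ a b → b :+ a :* b := (con 1ℚ :+ a) :* b) refl (fromℕ a) (fromℕ b) ⟩
  (1ℚ + fromℕ a) * fromℕ b     ≡⟨ cong (_* fromℕ b) (fromℕ-suc a) ⟨
  fromℕ (suc a) * fromℕ b      ∎
  where open ≡-Reasoning

0≤fromℕ : ∀ k → 0ℚ ≤ fromℕ k
0≤fromℕ k = nonNegative⁻¹ _ {{normalize-nonNeg k 1}}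

fromℕ-mono-≤ : ∀ {a b} → a ℕ.≤ b → fromℕ a ≤ fromℕ b
fromℕ-mono-≤ {a} {b} a≤b = begin
  fromℕ a                     ≡⟨ +-identityʳ (fromℕ a) ⟨
  fromℕ a + 0ℚ                ≤⟨ +-monoʳ-≤ (fromℕ a) (0≤fromℕ (b ℕ.∸ a)) ⟩
  fromℕ a + fromℕ (b ℕ.∸ a)   ≡⟨ fromℕ-+ a (b ℕ.∸ a) ⟨
  fromℕ (a ℕ.+ (b ℕ.∸ a))     ≡⟨ cong fromℕ (ℕ.m+[n∸m]≡n a≤b) ⟩
  fromℕ b                     ∎
  where open ≤-Reasoning

1≤fromℕ-suc : ∀ k → 1ℚ ≤ fromℕ (suc k)
1≤fromℕ-suc k = fromℕ-mono-≤ {1} {suc k} (ℕ.s≤s ℕ.z≤n)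

1/n*n≡1 : ∀ k → (+ 1 / suc k) * fromℕ (suc k) ≡ 1ℚ
1/n*n≡1 k = toℚᵘ-injective (begin
  toℚᵘ ((+ 1 / suc k) * fromℕ (suc k))          ≈⟨ toℚᵘ-homo-* (+ 1 / suc k) (fromℕ (suc k)) ⟩
  toℚᵘ (+ 1 / suc k) ℚᵘ.* toℚᵘ (fromℕ (suc k))  ≈⟨ ℚᵘ.*-cong (toℚᵘ-/ (+ 1) k) (toℚᵘ-/ (+ suc k) 0) ⟩
  ℚᵘ.mkℚᵘ (+ 1) k ℚᵘ.* ℚᵘ.mkℚᵘ (+ suc k) 0      ≈⟨ ℚᵘ.*≡* (trans (ℤ.*-identityʳ _) (trans (ℤ.*-identityˡ (+ suc k)) (sym (trans (ℤ.*-identityˡ _) (cong +_ (ℕ.*-identityʳ (suc k))))))) ⟩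
  ℚᵘ.1ℚᵘ                                        ∎)
  where open ℚᵘ.≃-Reasoning

fromℕ-suc-* : ∀ k p → fromℕ (suc k) * p ≡ p + fromℕ k * p
fromℕ-suc-* k p = begin
  fromℕ (suc k) * p     ≡⟨ cong (_* p) (fromℕ-suc k) ⟩
  (1ℚ + fromℕ k) * p    ≡⟨ solve 2 (λ a p → (con 1ℚ :+ a) :* p := p :+ a :* p) refl (fromℕ k) p ⟩
  p + fromℕ k * p       ∎
  where open ≡-Reasoning

-- The truncated logarithm series

infixr 8 _^_

_^_ : ℚ → ℕ → ℚ
y ^ zero  = 1ℚ
y ^ suc k = y * y ^ k

-- The N-th partial sum of -ln (1 - y).
logSeries : ℕ → ℚ → ℚ
logSeries zero    y = 0ℚ
logSeries (suc N) y = logSeries N y + (+ 1 / suc N) * y ^ suc N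

geomSeries : ℕ → ℚ → ℚ
geomSeries zero    y = 0ℚ
geomSeries (suc N) y = geomSeries N y + y ^ N

0≤1/n : ∀ k → 0ℚ ≤ + 1 / suc k
0≤1/n k = nonNegative⁻¹ _ {{normalize-nonNeg 1 (suc k)}}

0≤^ : ∀ {y} k → 0ℚ ≤ y → 0ℚ ≤ y ^ k
0≤^ zero    0≤y = ≤ᵇ⇒≤ _
0≤^ (suc k) 0≤y = 0≤* 0≤y (0≤^ k 0≤y)

^-mono-≤ : ∀ {a b} k → 0ℚ ≤ a → a ≤ b → a ^ k ≤ b ^ k
^-mono-≤ zero    0≤a a≤b = ≤-refl
^-mono-≤ (suc k) 0≤a a≤b = *-mono-≤ 0≤a a≤b (0≤^ k 0≤a) (^-mono-≤ k 0≤a a≤b)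

^-chebyshev : ∀ {a b} k → 0ℚ ≤ a → a ≤ b →
  (a + b) * (a ^ k + b ^ k) ≤ (1ℚ + 1ℚ) * (a ^ suc k + b ^ suc k)
^-chebyshev {a} {b} k 0≤a a≤b = ≤-by-gap ((b - a) * (b ^ k - a ^ k))
  (solve 4 (λ a b x y → (con 1ℚ :+ con 1ℚ) :* (a :* x :+ b :* y)
                      := (a :+ b) :* (x :+ y) :+ (b :- a) :* (y :- x)) refl a b (a ^ k) (b ^ k))
  (0≤* (p≤q⇒0≤q-p a≤b) (p≤q⇒0≤q-p (^-mono-≤ k 0≤a a≤b)))

-- The trapezoid rule overestimates ∫ₐᵇ (k+1) xᵏ dx, since xᵏ is convex on [0, ∞).
^-trapezoid : ∀ {a b} k → 0ℚ ≤ a → a ≤ b →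
  (b ^ suc k - a ^ suc k) + (b ^ suc k - a ^ suc k) ≤ fromℕ (suc k) * ((b - a) * (a ^ k + b ^ k))
^-trapezoid {a} {b} zero 0≤a a≤b = ≤-reflexive
  (solve 2 (λ a b → (b :* con 1ℚ :- a :* con 1ℚ) :+ (b :* con 1ℚ :- a :* con 1ℚ)
                  := con 1ℚ :* ((b :- a) :* (con 1ℚ :+ con 1ℚ))) refl a b)
^-trapezoid {a} {b} (suc k) 0≤a a≤b = *-cancelˡ-≤ (positive⁻¹ two) (begin
  two * (Δ + Δ)
    ≡⟨ solve 4 (λ a b A B → (con 1ℚ :+ con 1ℚ) :* ((b :* B :- a :* A) :+ (b :* B :- a :* A))
                          := (a :+ b) :* ((B :- A) :+ (B :- A)) :+ (con 1ℚ :+ con 1ℚ) :* ((b :- a) :* (A :+ B)))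
               refl a b A B ⟩
  (a + b) * ((B - A) + (B - A)) + two * ((b - a) * (A + B))
    ≤⟨ +-monoˡ-≤ _ (*-monoʳ-≤ (0≤+ 0≤a 0≤b) (^-trapezoid k 0≤a a≤b)) ⟩
  (a + b) * (k+1 * ((b - a) * (a ^ k + b ^ k))) + two * ((b - a) * (A + B))
    ≡⟨ cong (_+ two * ((b - a) * (A + B)))
         (solve 5 (λ a b x y c → (a :+ b) :* (c :* ((b :- a) :* (x :+ y))) := (c :* (b :- a)) :* ((a :+ b) :* (x :+ y)))
                refl a b (a ^ k) (b ^ k) k+1) ⟩
  (k+1 * (b - a)) * ((a + b) * (a ^ k + b ^ k)) + two * ((b - a) * (A + B))
    ≤⟨ +-monoˡ-≤ _ (*-monoʳ-≤ (0≤* (0≤fromℕ (suc k)) (p≤q⇒0≤q-p a≤b)) (^-chebyshev k 0≤a a≤b)) ⟩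
  (k+1 * (b - a)) * (two * (A + B)) + two * ((b - a) * (A + B))
    ≡⟨ solve 4 (λ a b S c → (c :* (b :- a)) :* ((con 1ℚ :+ con 1ℚ) :* S) :+ (con 1ℚ :+ con 1ℚ) :* ((b :- a) :* S)
                          := (con 1ℚ :+ con 1ℚ) :* ((con 1ℚ :+ c) :* ((b :- a) :* S))) refl a b (A + B) k+1 ⟩
  two * ((1ℚ + k+1) * ((b - a) * (A + B)))
    ≡⟨ cong (λ c → two * (c * ((b - a) * (A + B)))) (fromℕ-suc (suc k)) ⟨
  two * (fromℕ (suc (suc k)) * ((b - a) * (A + B))) ∎)
  where
  open ≤-Reasoning
  two = 1ℚ + 1ℚ
  k+1 = fromℕ (suc k)
  0≤b = ≤-trans 0≤a a≤b
  A = a ^ suc k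
  B = b ^ suc k
  Δ = b ^ suc (suc k) - a ^ suc (suc k)

-- geomSeries N is the derivative of logSeries N; apply ^-trapezoid termwise.
logSeries-trapezoid : ∀ {y y′} N → 0ℚ ≤ y → y ≤ y′ →
  (logSeries N y′ - logSeries N y) + (logSeries N y′ - logSeries N y) ≤ (y′ - y) * (geomSeries N y + geomSeries N y′)
logSeries-trapezoid {y} {y′} zero 0≤y y≤y′ = ≤-reflexive
  (solve 2 (λ y y′ → (con 0ℚ :- con 0ℚ) :+ (con 0ℚ :- con 0ℚ) := (y′ :- y) :* (con 0ℚ :+ con 0ℚ)) refl y y′)
logSeries-trapezoid {y} {y′} (suc N) 0≤y y≤y′ = begin
  (logSeries (suc N) y′ - logSeries (suc N) y) + (logSeries (suc N) y′ - logSeries (suc N) y)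
    ≡⟨ solve 5 (λ f f′ c q q′ → ((f′ :+ c :* q′) :- (f :+ c :* q)) :+ ((f′ :+ c :* q′) :- (f :+ c :* q))
                              := ((f′ :- f) :+ (f′ :- f)) :+ c :* ((q′ :- q) :+ (q′ :- q)))
               refl (logSeries N y) (logSeries N y′) 1/N+1 (y ^ suc N) (y′ ^ suc N) ⟩
  ((logSeries N y′ - logSeries N y) + (logSeries N y′ - logSeries N y))
    + 1/N+1 * ((y′ ^ suc N - y ^ suc N) + (y′ ^ suc N - y ^ suc N))
    ≤⟨ +-mono-≤ (logSeries-trapezoid N 0≤y y≤y′) (*-monoʳ-≤ (0≤1/n N) (^-trapezoid N 0≤y y≤y′)) ⟩
  (y′ - y) * (G + G′) + 1/N+1 * (fromℕ (suc N) * ((y′ - y) * (y ^ N + y′ ^ N)))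
    ≡⟨ cong (λ z → (y′ - y) * (G + G′) + z) (begin-equality
         1/N+1 * (fromℕ (suc N) * D)   ≡⟨ *-assoc 1/N+1 (fromℕ (suc N)) D ⟨
         (1/N+1 * fromℕ (suc N)) * D   ≡⟨ cong (_* D) (1/n*n≡1 N) ⟩
         1ℚ * D                        ≡⟨ *-identityˡ D ⟩
         D                             ∎) ⟩
  (y′ - y) * (G + G′) + (y′ - y) * (y ^ N + y′ ^ N)
    ≡⟨ solve 5 (λ d g g′ p p′ → d :* (g :+ g′) :+ d :* (p :+ p′) := d :* ((g :+ p) :+ (g′ :+ p′)))
               refl (y′ - y) G G′ (y ^ N) (y′ ^ N) ⟩
  (y′ - y) * (geomSeries (suc N) y + geomSeries (suc N) y′) ∎
  where
  open ≤-Reasoning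
  1/N+1 = + 1 / suc N
  G = geomSeries N y
  G′ = geomSeries N y′
  D = (y′ - y) * (y ^ N + y′ ^ N)

[1-y]*geomSeries≡1-yᴺ : ∀ y N → (1ℚ - y) * geomSeries N y ≡ 1ℚ - y ^ N
[1-y]*geomSeries≡1-yᴺ y zero = solve 1 (λ y → (con 1ℚ :- y) :* con 0ℚ := con 1ℚ :- con 1ℚ) refl y
[1-y]*geomSeries≡1-yᴺ y (suc N) = begin
  (1ℚ - y) * (geomSeries N y + y ^ N)                ≡⟨ *-distribˡ-+ (1ℚ - y) (geomSeries N y) (y ^ N) ⟩
  (1ℚ - y) * geomSeries N y + (1ℚ - y) * y ^ N       ≡⟨ cong (_+ (1ℚ - y) * y ^ N) ([1-y]*geomSeries≡1-yᴺ y N) ⟩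
  (1ℚ - y ^ N) + (1ℚ - y) * y ^ N                    ≡⟨ solve 2 (λ y p → (con 1ℚ :- p) :+ (con 1ℚ :- y) :* p := con 1ℚ :- y :* p) refl y (y ^ N) ⟩
  1ℚ - y ^ suc N                                     ∎
  where open ≡-Reasoning

[1-y]*geomSeries≤1 : ∀ {y} N → 0ℚ ≤ y → (1ℚ - y) * geomSeries N y ≤ 1ℚ
[1-y]*geomSeries≤1 {y} N 0≤y = begin
  (1ℚ - y) * geomSeries N y   ≡⟨ [1-y]*geomSeries≡1-yᴺ y N ⟩
  1ℚ - y ^ N                  ≤⟨ ≤-by-gap (y ^ N) (solve 1 (λ p → con 1ℚ := (con 1ℚ :- p) :+ p) refl (y ^ N)) (0≤^ N 0≤y) ⟩
  1ℚ                          ∎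
  where open ≤-Reasoning

p*geomSeries[1-p]≤1 : ∀ {p} N → p ≤ 1ℚ → p * geomSeries N (1ℚ - p) ≤ 1ℚ
p*geomSeries[1-p]≤1 {p} N p≤1 = begin
  p * geomSeries N (1ℚ - p)                 ≡⟨ cong (_* geomSeries N (1ℚ - p)) (solve 1 (λ p → p := con 1ℚ :- (con 1ℚ :- p)) refl p) ⟩
  (1ℚ - (1ℚ - p)) * geomSeries N (1ℚ - p)   ≤⟨ [1-y]*geomSeries≤1 N (p≤q⇒0≤q-p p≤1) ⟩
  1ℚ                                        ∎
  where open ≤-Reasoning

-- As p / p′ = B / A, this is a truncated form of ln (B / A) ≤ (B / A - A / B) / 2.
logSeries-increment : ∀ N {A B p p′} → 0ℚ ≤ A → A ≤ B → p * A ≡ p′ * B → 0ℚ ≤ p′ → p′ ≤ p → p ≤ 1ℚ →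
  (A * B) * ((logSeries N (1ℚ - p′) - logSeries N (1ℚ - p)) + (logSeries N (1ℚ - p′) - logSeries N (1ℚ - p)))
    ≤ B * B - A * A
logSeries-increment N {A} {B} {p} {p′} 0≤A A≤B pA≡p′B 0≤p′ p′≤p p≤1 = begin
  (A * B) * (Δ + Δ)
    ≤⟨ *-monoʳ-≤ (0≤* 0≤A 0≤B) (logSeries-trapezoid N (p≤q⇒0≤q-p p≤1) y≤y′) ⟩
  (A * B) * ((y′ - y) * (G + G′))
    ≡⟨ solve 6 (λ A B p p′ g g′ → (A :* B) :* (((con 1ℚ :- p′) :- (con 1ℚ :- p)) :* (g :+ g′))
                                := (A :* B :* (p :- p′)) :* g :+ (A :* B :* (p :- p′)) :* g′) refl A B p p′ G G′ ⟩
  (A * B * (p - p′)) * G + (A * B * (p - p′)) * G′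
    ≡⟨ cong₂ _+_ (trans (cong (_* G) ABΔp≡A[B-A]p) (*-assoc (A * (B - A)) p G))
                 (trans (cong (_* G′) ABΔp≡B[B-A]p′) (*-assoc (B * (B - A)) p′ G′)) ⟩
  (A * (B - A)) * (p * G) + (B * (B - A)) * (p′ * G′)
    ≤⟨ +-mono-≤ (*-monoʳ-≤ (0≤* 0≤A 0≤B-A) (p*geomSeries[1-p]≤1 N p≤1))
                (*-monoʳ-≤ (0≤* 0≤B 0≤B-A) (p*geomSeries[1-p]≤1 N (≤-trans p′≤p p≤1))) ⟩
  (A * (B - A)) * 1ℚ + (B * (B - A)) * 1ℚ
    ≡⟨ solve 2 (λ A B → (A :* (B :- A)) :* con 1ℚ :+ (B :* (B :- A)) :* con 1ℚ := B :* B :- A :* A) refl A B ⟩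
  B * B - A * A ∎
  where
  open ≤-Reasoning
  y = 1ℚ - p
  y′ = 1ℚ - p′
  Δ = logSeries N y′ - logSeries N y
  G = geomSeries N y
  G′ = geomSeries N y′
  0≤B = ≤-trans 0≤A A≤B
  0≤B-A = p≤q⇒0≤q-p A≤B
  y≤y′ : y ≤ y′
  y≤y′ = ≤-by-gap (p - p′) (solve 2 (λ p p′ → con 1ℚ :- p′ := (con 1ℚ :- p) :+ (p :- p′)) refl p p′) (p≤q⇒0≤q-p p′≤p)
  ABΔp≡A[B-A]p : A * B * (p - p′) ≡ (A * (B - A)) * p
  ABΔp≡A[B-A]p = begin-equality
    A * B * (p - p′)        ≡⟨ solve 4 (λ A B p p′ → A :* B :* (p :- p′) := A :* B :* p :- A :* (p′ :* B)) refl A B p p′ ⟩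
    A * B * p - A * (p′ * B) ≡⟨ cong (λ z → A * B * p - A * z) pA≡p′B ⟨
    A * B * p - A * (p * A)  ≡⟨ solve 3 (λ A B p → A :* B :* p :- A :* (p :* A) := (A :* (B :- A)) :* p) refl A B p ⟩
    (A * (B - A)) * p        ∎
  ABΔp≡B[B-A]p′ : A * B * (p - p′) ≡ (B * (B - A)) * p′
  ABΔp≡B[B-A]p′ = begin-equality
    A * B * (p - p′)         ≡⟨ solve 4 (λ A B p p′ → A :* B :* (p :- p′) := B :* (p :* A) :- A :* B :* p′) refl A B p p′ ⟩
    B * (p * A) - A * B * p′ ≡⟨ cong (λ z → B * z - A * B * p′) pA≡p′B ⟩
    B * (p′ * B) - A * B * p′ ≡⟨ solve 3 (λ A B p′ → B :* (p′ :* B) :- A :* B :* p′ := (B :* (B :- A)) :* p′) refl A B p′ ⟩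
    (B * (B - A)) * p′       ∎

logSeries-mono-≤ : ∀ N {y y′} → 0ℚ ≤ y → y ≤ y′ → logSeries N y ≤ logSeries N y′
logSeries-mono-≤ zero    0≤y y≤y′ = ≤-refl
logSeries-mono-≤ (suc N) 0≤y y≤y′ =
  +-mono-≤ (logSeries-mono-≤ N 0≤y y≤y′) (*-monoʳ-≤ (0≤1/n N) (^-mono-≤ (suc N) 0≤y y≤y′))

logSeries-0 : ∀ N → logSeries N 0ℚ ≡ 0ℚ
logSeries-0 zero    = refl
logSeries-0 (suc N) = trans (cong (_+ (+ 1 / suc N) * (0ℚ * 0ℚ ^ N)) (logSeries-0 N))
  (solve 2 (λ c q → con 0ℚ :+ c :* (con 0ℚ :* q) := con 0ℚ) refl (+ 1 / suc N) (0ℚ ^ N))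

½^≡halfPow : ∀ k → ½ ^ k ≡ halfPow k
½^≡halfPow zero    = refl
½^≡halfPow (suc k) = cong (½ *_) (½^≡halfPow k)

logSeries-½ : ∀ N → logSeries N ½ ≡ lnTwoPartial N
logSeries-½ zero    = refl
logSeries-½ (suc N) = cong₂ (λ s h → s + (+ 1 / suc N) * h) (logSeries-½ N) (½^≡halfPow (suc N))

-- Partial sums of ln 2

1/n-antimono-≤ : ∀ {M N} → M ℕ.≤ N → + 1 / suc N ≤ + 1 / suc M
1/n-antimono-≤ {M} {N} M≤N = subst₂ _≤_ (sym (1/n≡mkℚ N)) (sym (1/n≡mkℚ M))
  (*≤* (subst₂ ℤ._≤_ (sym (ℤ.*-identityˡ (+ suc M))) (sym (ℤ.*-identityˡ (+ suc N))) (ℤ.+≤+ (ℕ.s≤s M≤N))))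
  where
  1/n≡mkℚ : ∀ k → + 1 / suc k ≡ mkℚ (+ 1) k (1-coprimeTo (suc k))
  1/n≡mkℚ k = normalize-coprime (1-coprimeTo (suc k))

0≤halfPow : ∀ k → 0ℚ ≤ halfPow k
0≤halfPow k = subst (0ℚ ≤_) (½^≡halfPow k) (0≤^ k (≤ᵇ⇒≤ _))

halfPow-antimono-≤ : ∀ {M N} → M ≤′ N → halfPow N ≤ halfPow M
halfPow-antimono-≤ ≤′-refl = ≤-refl
halfPow-antimono-≤ {M} {suc N} (≤′-step M≤N) = ≤-trans
  (≤-by-gap (½ * halfPow N) (solve 1 (λ h → h := con ½ :* h :+ con ½ :* h) refl (halfPow N)) (0≤* {½} (≤ᵇ⇒≤ _) (0≤halfPow N)))
  (halfPow-antimono-≤ M≤N)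

lnTwoPartial-mono-≤ : ∀ {M N} → M ≤′ N → lnTwoPartial M ≤ lnTwoPartial N
lnTwoPartial-mono-≤ ≤′-refl = ≤-refl
lnTwoPartial-mono-≤ {M} {suc N} (≤′-step M≤N) = ≤-trans (lnTwoPartial-mono-≤ M≤N)
  (≤-by-gap ((+ 1 / suc N) * halfPow (suc N)) refl (0≤* (0≤1/n N) (0≤halfPow (suc N))))

-- The tail Σ_{k>M} 2⁻ᵏ/k is at most (1/(M+1)) Σ_{k>M} 2⁻ᵏ.
lnTwoPartial-tail : ∀ {M N} → M ≤′ N →
  lnTwoPartial N + (+ 1 / suc M) * halfPow N ≤ lnTwoPartial M + (+ 1 / suc M) * halfPow M
lnTwoPartial-tail ≤′-refl = ≤-refl
lnTwoPartial-tail {M} {suc N} (≤′-step M≤N) = begin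
  lnTwoPartial N + (+ 1 / suc N) * h′ + c * h′  ≤⟨ +-monoˡ-≤ (c * h′) (+-monoʳ-≤ (lnTwoPartial N) (*-monoˡ-≤ (0≤halfPow (suc N)) 1/N+1≤c)) ⟩
  lnTwoPartial N + c * h′ + c * h′              ≡⟨ solve 3 (λ L c h → L :+ c :* (con ½ :* h) :+ c :* (con ½ :* h) := L :+ c :* h) refl (lnTwoPartial N) c (halfPow N) ⟩
  lnTwoPartial N + c * halfPow N                ≤⟨ lnTwoPartial-tail M≤N ⟩
  lnTwoPartial M + c * halfPow M                ∎
  where
  open ≤-Reasoning
  c = + 1 / suc M
  h′ = halfPow (suc N)
  1/N+1≤c : + 1 / suc N ≤ c
  1/N+1≤c = 1/n-antimono-≤ (ℕ.≤′⇒≤ M≤N)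

lnTwoPartial-upper : ∀ M N → lnTwoPartial N ≤ lnTwoPartial M + (+ 1 / suc M) * halfPow M
lnTwoPartial-upper M N with ℕ.≤-total M N
... | inj₁ M≤N = ≤-trans
  (≤-by-gap ((+ 1 / suc M) * halfPow N) refl (0≤* (0≤1/n M) (0≤halfPow N)))
  (lnTwoPartial-tail (ℕ.≤⇒≤′ M≤N))
... | inj₂ N≤M = ≤-trans (lnTwoPartial-mono-≤ (ℕ.≤⇒≤′ N≤M))
  (≤-by-gap ((+ 1 / suc M) * halfPow M) refl (0≤* (0≤1/n M) (0≤halfPow M)))

-- Runs and packings

accepted : ∀ {n} → Assignment n → ℕ
accepted []                   = 0
accepted ((x , nothing) ∷ as) = accepted as
accepted ((x , just j) ∷ as)  = suc (accepted as)

accepted-++ : ∀ {n} (as bs : Assignment n) → accepted (as ++ bs) ≡ accepted as ℕ.+ accepted bs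
accepted-++ []                   bs = refl
accepted-++ ((x , nothing) ∷ as) bs = accepted-++ as bs
accepted-++ ((x , just j) ∷ as)  bs = cong suc (accepted-++ as bs)

value-++ : ∀ {n} (as bs : Assignment n) → value (as ++ bs) ≡ value as + value bs
value-++ []                   bs = sym (+-identityˡ _)
value-++ ((x , nothing) ∷ as) bs = value-++ as bs
value-++ ((x , just j) ∷ as)  bs = trans (cong (_+_ x) (value-++ as bs)) (sym (+-assoc x _ _))

0≤value : ∀ {n} (as : Assignment n) → All ((0ℚ ≤_) ∘ proj₁) as → 0ℚ ≤ value as
0≤value []                   []             = ≤-refl
0≤value ((x , nothing) ∷ as) (_ ∷ as≥0)     = 0≤value as as≥0
0≤value ((x , just j) ∷ as)  (0≤x ∷ as≥0)   = 0≤+ 0≤x (0≤value as as≥0)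

value-replicate : ∀ {n} s k (ds : List (Decision n)) →
  value (zip (replicate k s) ds) ≡ fromℕ (accepted (zip (replicate k s) ds)) * s
value-replicate s zero    ds             = sym (*-zeroˡ s)
value-replicate s (suc k) []             = sym (*-zeroˡ s)
value-replicate s (suc k) (nothing ∷ ds) = value-replicate s k ds
value-replicate s (suc k) (just j ∷ ds)  =
  trans (cong (_+_ s) (value-replicate s k ds)) (sym (fromℕ-suc-* (accepted (zip (replicate k s) ds)) s))

value≤accepted*s : ∀ {n s} (as : Assignment n) → All ((_≤ s) ∘ proj₁) as → value as ≤ fromℕ (accepted as) * s
value≤accepted*s {s = s} []                   []         = ≤-reflexive (sym (*-zeroˡ s))
value≤accepted*s         ((x , nothing) ∷ as) (_ ∷ as≤s) = value≤accepted*s as as≤s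
value≤accepted*s {s = s} ((x , just j) ∷ as)  (x≤s ∷ as≤s) =
  ≤-trans (+-mono-≤ x≤s (value≤accepted*s as as≤s)) (≤-reflexive (sym (fromℕ-suc-* (accepted as) s)))

load-++ : ∀ {n} (as bs : Assignment n) i → load (as ++ bs) i ≡ load as i + load bs i
load-++ []                   bs i = sym (+-identityˡ _)
load-++ ((x , nothing) ∷ as) bs i = load-++ as bs i
load-++ ((x , just j) ∷ as)  bs i with j ≟ i
... | yes _ = trans (cong (_+_ x) (load-++ as bs i)) (sym (+-assoc x _ _))
... | no _  = load-++ as bs i

decisionsFrom-++ : ∀ {n} (A : OnlineAlg n) h xs ys →
  decisionsFrom A h (xs ++ ys) ≡ decisionsFrom A h xs ++ decisionsFrom A (h ++ xs) ys
decisionsFrom-++ A h []       ys = cong (λ h → decisionsFrom A h ys) (sym (List.++-identityʳ h))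
decisionsFrom-++ A h (x ∷ xs) ys = cong (decide A h x ∷_) (begin
  decisionsFrom A (h ++ x ∷ []) (xs ++ ys)
    ≡⟨ decisionsFrom-++ A (h ++ x ∷ []) xs ys ⟩
  decisionsFrom A (h ++ x ∷ []) xs ++ decisionsFrom A ((h ++ x ∷ []) ++ xs) ys
    ≡⟨ cong (λ h′ → decisionsFrom A (h ++ x ∷ []) xs ++ decisionsFrom A h′ ys) (List.++-assoc h (x ∷ []) xs) ⟩
  decisionsFrom A (h ++ x ∷ []) xs ++ decisionsFrom A (h ++ x ∷ xs) ys ∎)
  where open ≡-Reasoning

length-decisionsFrom : ∀ {n} (A : OnlineAlg n) h xs → length (decisionsFrom A h xs) ≡ length xs
length-decisionsFrom A h []       = refl
length-decisionsFrom A h (x ∷ xs) = cong suc (length-decisionsFrom A (h ++ x ∷ []) xs)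

zip-++ : ∀ {A B : Set} (xs ys : List A) (ds es : List B) → length ds ≡ length xs →
  zip (xs ++ ys) (ds ++ es) ≡ zip xs ds ++ zip ys es
zip-++ []       ys []       es _   = refl
zip-++ (x ∷ xs) ys (d ∷ ds) es len = cong ((x , d) ∷_) (zip-++ xs ys ds es (ℕ.suc-injective len))

run-++ : ∀ {n} (A : OnlineAlg n) σ τ → run A (σ ++ τ) ≡ run A σ ++ zip τ (decisionsFrom A σ τ)
run-++ A σ τ = trans (cong (zip (σ ++ τ)) (decisionsFrom-++ A [] σ τ))
  (zip-++ σ τ (decisions A σ) (decisionsFrom A σ τ) (length-decisionsFrom A [] σ))

All-zip : ∀ {n} {P : ℚ → Set} (xs : List ℚ) (ds : List (Decision n)) → All P xs → All (P ∘ proj₁) (zip xs ds)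
All-zip []       ds       []         = []
All-zip (x ∷ xs) []       (px ∷ pxs) = []
All-zip (x ∷ xs) (d ∷ ds) (px ∷ pxs) = px ∷ All-zip xs ds pxs

-- Items larger than ½

LargeItems : ∀ {n} → Assignment n → Set
LargeItems = All ((½ <_) ∘ proj₁)

Large≤ : ℚ → ℚ → Set
Large≤ s x = ½ < x × x ≤ s

load-cons-≡ : ∀ {n} x (j : Fin n) as → load ((x , just j) ∷ as) j ≡ x + load as j
load-cons-≡ x j as with j ≟ j
... | yes _   = refl
... | no j≢j  = ⊥-elim (j≢j refl)

load-cons-≢ : ∀ {n} x {j i : Fin n} as → j ≢ i → load ((x , just j) ∷ as) i ≡ load as i
load-cons-≢ x {j} {i} as j≢i with j ≟ i
... | yes j≡i = ⊥-elim (j≢i j≡i)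
... | no _    = refl

load-cons-≥ : ∀ {n} {x} (d : Decision n) as i → 0ℚ ≤ x → load as i ≤ load ((x , d) ∷ as) i
load-cons-≥         nothing  as i 0≤x = ≤-refl
load-cons-≥ {x = x} (just j) as i 0≤x with j ≟ i
... | yes _ = ≤-by-gap x (+-comm x (load as i)) 0≤x
... | no _  = ≤-refl

Feasible-tail : ∀ {n} {x} (d : Decision n) as → 0ℚ ≤ x → Feasible ((x , d) ∷ as) → Feasible as
Feasible-tail d as 0≤x feasible i = ≤-trans (load-cons-≥ d as i 0≤x) (feasible i)

load≡0⊎½<load : ∀ {n} (as : Assignment n) → LargeItems as → ∀ i → load as i ≡ 0ℚ ⊎ ½ < load as i
load≡0⊎½<load []                   []         i = inj₁ refl
load≡0⊎½<load ((x , nothing) ∷ as) (_ ∷ large) i = load≡0⊎½<load as large i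
load≡0⊎½<load ((x , just j) ∷ as)  (½<x ∷ large) i with j ≟ i | load≡0⊎½<load as large i
... | no _  | loadᵢ = loadᵢ
... | yes _ | inj₁ empty = inj₂ (<-≤-trans ½<x (≤-reflexive (sym (trans (cong (_+_ x) empty) (+-identityʳ x)))))
... | yes _ | inj₂ ½<loadᵢ = inj₂ (<-≤-trans ½<x (≤-by-gap (load as i) refl (<⇒≤ (<-trans 0<½ ½<loadᵢ))))

-- Two items larger than ½ never share a bin.
target-bin-empty : ∀ {n} x (j : Fin n) as → LargeItems ((x , just j) ∷ as) → Feasible ((x , just j) ∷ as) → load as j ≡ 0ℚ
target-bin-empty x j as (½<x ∷ large) feasible with load≡0⊎½<load as large j
... | inj₁ empty    = empty
... | inj₂ ½<loadⱼ  = ⊥-elim (<-irrefl refl (begin-strict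
  1ℚ               ≡⟨⟩
  ½ + ½            <⟨ +-mono-< ½<x ½<loadⱼ ⟩
  x + load as j    ≡⟨ load-cons-≡ x j as ⟨
  load ((x , just j) ∷ as) j ≤⟨ feasible j ⟩
  1ℚ               ∎))
  where open ≤-Reasoning

isEmpty : ℚ → ℕ
isEmpty q with q ℚ.≟ 0ℚ
... | yes _ = 1
... | no _  = 0

emptyBins : ∀ {n} → Assignment n → ℕ
emptyBins as = sum (λ i → isEmpty (load as i))

sum-ones : ∀ n → sum {n} (λ _ → 1) ≡ n
sum-ones zero    = refl
sum-ones (suc n) = cong suc (sum-ones n)

sum-suc-at : ∀ {n} (f g : Fin n → ℕ) j → g j ≡ suc (f j) → (∀ i → j ≢ i → g i ≡ f i) → sum g ≡ suc (sum f)
sum-suc-at f g zero    gⱼ≡1+fⱼ gᵢ≡fᵢ =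
  cong₂ ℕ._+_ gⱼ≡1+fⱼ (sum-cong-≗ (λ i → gᵢ≡fᵢ (suc i) (λ ())))
sum-suc-at f g (suc j) gⱼ≡1+fⱼ gᵢ≡fᵢ = begin
  g zero ℕ.+ sum (g ∘ suc)         ≡⟨ cong₂ ℕ._+_ (gᵢ≡fᵢ zero (λ ())) (sum-suc-at (f ∘ suc) (g ∘ suc) j gⱼ≡1+fⱼ (λ i j≢i → gᵢ≡fᵢ (suc i) (j≢i ∘ Fin.suc-injective))) ⟩
  f zero ℕ.+ suc (sum (f ∘ suc))   ≡⟨ ℕ.+-suc (f zero) _ ⟩
  suc (f zero ℕ.+ sum (f ∘ suc))   ∎
  where open ≡-Reasoning

accepted+emptyBins≡n : ∀ {n} (as : Assignment n) → LargeItems as → Feasible as → accepted as ℕ.+ emptyBins as ≡ n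
accepted+emptyBins≡n {n} []                   []            feasible = sum-ones n
accepted+emptyBins≡n     ((x , nothing) ∷ as) (_ ∷ large)   feasible = accepted+emptyBins≡n as large feasible
accepted+emptyBins≡n {n} ((x , just j) ∷ as)  (½<x ∷ large) feasible = begin
  suc (accepted as) ℕ.+ emptyBins cons   ≡⟨ ℕ.+-suc (accepted as) (emptyBins cons) ⟨
  accepted as ℕ.+ suc (emptyBins cons)   ≡⟨ cong (accepted as ℕ.+_) one-fewer-empty ⟨
  accepted as ℕ.+ emptyBins as           ≡⟨ accepted+emptyBins≡n as large (Feasible-tail (just j) as 0≤x feasible) ⟩
  n                                      ∎
  where
  open ≡-Reasoning
  cons = (x , just j) ∷ as
  0≤x = <⇒≤ (<-trans 0<½ ½<x)
  emptyⱼ : load as j ≡ 0ℚ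
  emptyⱼ = target-bin-empty x j as (½<x ∷ large) feasible
  filledⱼ : isEmpty (load cons j) ≡ 0
  filledⱼ with load cons j ℚ.≟ 0ℚ
  ... | no _  = refl
  ... | yes loadⱼ≡0 = ⊥-elim (<-irrefl (sym loadⱼ≡0) (<-≤-trans (<-trans 0<½ ½<x)
          (≤-reflexive (sym (trans (load-cons-≡ x j as) (trans (cong (_+_ x) emptyⱼ) (+-identityʳ x)))))))
  one-fewer-empty : emptyBins as ≡ suc (emptyBins cons)
  one-fewer-empty = sum-suc-at (λ i → isEmpty (load cons i)) (λ i → isEmpty (load as i)) j
    (trans (cong isEmpty emptyⱼ) (cong suc (sym filledⱼ)))
    (λ i j≢i → cong isEmpty (sym (load-cons-≢ x as j≢i)))

accepted≤n : ∀ {n} (as : Assignment n) → LargeItems as → Feasible as → accepted as ℕ.≤ n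
accepted≤n as large feasible = subst (accepted as ℕ.≤_) (accepted+emptyBins≡n as large feasible) (ℕ.m≤m+n (accepted as) (emptyBins as))

rejectAll : ∀ {n} → ℕ → List (Decision n)
rejectAll k = replicate k nothing

load-rejectAll : ∀ {n} (xs : List ℚ) k (i : Fin n) → load (zip xs (rejectAll k)) i ≡ 0ℚ
load-rejectAll []       k       i = refl
load-rejectAll (x ∷ xs) zero    i = refl
load-rejectAll (x ∷ xs) (suc k) i = load-rejectAll xs k i

value-rejectAll : ∀ {n} (xs : List ℚ) k → value {n} (zip xs (rejectAll k)) ≡ 0ℚ
value-rejectAll []       k       = refl
value-rejectAll (x ∷ xs) zero    = refl
value-rejectAll (x ∷ xs) (suc k) = value-rejectAll xs k

spread : (n : ℕ) → List (Decision n)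
spread zero    = []
spread (suc n) = just zero ∷ map (Maybe.map suc) (spread n)

length-spread : ∀ n → length (spread n) ≡ n
length-spread zero    = refl
length-spread (suc n) = cong suc (trans (List.length-map (Maybe.map suc) (spread n)) (length-spread n))

module _ {n : ℕ} where

  load-shift-zero : ∀ xs (ds : List (Decision n)) → load (zip xs (map (Maybe.map suc) ds)) zero ≡ 0ℚ
  load-shift-zero []       ds             = refl
  load-shift-zero (x ∷ xs) []             = refl
  load-shift-zero (x ∷ xs) (nothing ∷ ds) = load-shift-zero xs ds
  load-shift-zero (x ∷ xs) (just j ∷ ds)  = load-shift-zero xs ds

  load-shift-suc : ∀ xs (ds : List (Decision n)) i → load (zip xs (map (Maybe.map suc) ds)) (suc i) ≡ load (zip xs ds) i
  load-shift-suc []       ds             i = refl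
  load-shift-suc (x ∷ xs) []             i = refl
  load-shift-suc (x ∷ xs) (nothing ∷ ds) i = load-shift-suc xs ds i
  load-shift-suc (x ∷ xs) (just j ∷ ds)  i with j ≟ i
  ... | yes _ = cong (_+_ x) (load-shift-suc xs ds i)
  ... | no _  = load-shift-suc xs ds i

  accepted-shift : ∀ xs (ds : List (Decision n)) → accepted (zip xs (map (Maybe.map suc) ds)) ≡ accepted (zip xs ds)
  accepted-shift []       ds             = refl
  accepted-shift (x ∷ xs) []             = refl
  accepted-shift (x ∷ xs) (nothing ∷ ds) = accepted-shift xs ds
  accepted-shift (x ∷ xs) (just j ∷ ds)  = cong suc (accepted-shift xs ds)

load-spread : ∀ n s i → load (zip (replicate n s) (spread n)) i ≡ s
load-spread (suc n) s zero    = trans (cong (_+_ s) (load-shift-zero (replicate n s) (spread n))) (+-identityʳ s)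
load-spread (suc n) s (suc i) = trans (load-shift-suc (replicate n s) (spread n) i) (load-spread n s i)

accepted-spread : ∀ n s → accepted (zip (replicate n s) (spread n)) ≡ n
accepted-spread zero    s = refl
accepted-spread (suc n) s = cong suc (trans (accepted-shift (replicate n s) (spread n)) (accepted-spread n s))

IsOPT-++-replicate : ∀ n σ {s} → ½ < s → s ≤ 1ℚ → All (Large≤ s) σ → IsOPT n (σ ++ replicate n s) (fromℕ n * s)
IsOPT-++-replicate n σ {s} ½<s s≤1 σ-large = (ds , length-ds , feasible-ds , value-ds) , optimal
  where
  σ′ = σ ++ replicate n s
  ds = rejectAll (length σ) ++ spread n
  length-rejectAll : length (rejectAll {n} (length σ)) ≡ length σ
  length-rejectAll = List.length-replicate (length σ)
  length-ds : length ds ≡ length σ′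
  length-ds = begin
    length ds                                     ≡⟨ List.length-++ (rejectAll (length σ)) ⟩
    length (rejectAll {n} (length σ)) ℕ.+ length (spread n) ≡⟨ cong₂ ℕ._+_ length-rejectAll (length-spread n) ⟩
    length σ ℕ.+ n                                ≡⟨ cong (length σ ℕ.+_) (List.length-replicate n) ⟨
    length σ ℕ.+ length (replicate n s)           ≡⟨ List.length-++ σ ⟨
    length σ′                                     ∎
    where open ≡-Reasoning
  packing : zip σ′ ds ≡ zip σ (rejectAll (length σ)) ++ zip (replicate n s) (spread n)
  packing = zip-++ σ (replicate n s) (rejectAll (length σ)) (spread n) length-rejectAll
  feasible-ds : Feasible (zip σ′ ds)
  feasible-ds i = subst (λ as → load as i ≤ 1ℚ) (sym packing) (≤-trans (≤-reflexive (begin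
    load (zip σ (rejectAll (length σ)) ++ zip (replicate n s) (spread n)) i
      ≡⟨ load-++ (zip σ (rejectAll (length σ))) _ i ⟩
    load (zip σ (rejectAll (length σ))) i + load (zip (replicate n s) (spread n)) i
      ≡⟨ cong₂ _+_ (load-rejectAll σ (length σ) i) (load-spread n s i) ⟩
    0ℚ + s
      ≡⟨ +-identityˡ s ⟩
    s ∎)) s≤1)
    where open ≡-Reasoning
  value-ds : value (zip σ′ ds) ≡ fromℕ n * s
  value-ds = begin
    value (zip σ′ ds)                                                        ≡⟨ cong value packing ⟩
    value (zip σ (rejectAll (length σ)) ++ zip (replicate n s) (spread n))   ≡⟨ value-++ (zip σ (rejectAll (length σ))) _ ⟩
    value (zip σ (rejectAll {n} (length σ))) + value (zip (replicate n s) (spread n))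
      ≡⟨ cong₂ _+_ (value-rejectAll σ (length σ)) (value-replicate s n (spread n)) ⟩
    0ℚ + fromℕ (accepted (zip (replicate n s) (spread n))) * s               ≡⟨ +-identityˡ _ ⟩
    fromℕ (accepted (zip (replicate n s) (spread n))) * s                    ≡⟨ cong (λ k → fromℕ k * s) (accepted-spread n s) ⟩
    fromℕ n * s                                                              ∎
    where open ≡-Reasoning
  σ′-large : All (Large≤ s) σ′
  σ′-large = ++⁺ σ-large (replicate⁺ n (½<s , ≤-refl))
  optimal : ∀ ds → length ds ≡ length σ′ → Feasible (zip σ′ ds) → value (zip σ′ ds) ≤ fromℕ n * s
  optimal ds _ feasible = begin
    value (zip σ′ ds)                      ≤⟨ value≤accepted*s (zip σ′ ds) (All.map proj₂ (All-zip σ′ ds σ′-large)) ⟩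
    fromℕ (accepted (zip σ′ ds)) * s       ≤⟨ *-monoˡ-≤ (<⇒≤ (<-trans 0<½ ½<s)) (fromℕ-mono-≤ (accepted≤n (zip σ′ ds) (All.map proj₁ (All-zip σ′ ds σ′-large)) feasible)) ⟩
    fromℕ n * s                            ∎
    where open ≤-Reasoning

-- Sizes and their half-inverses p = 1/(2s)

module _ (s : ℚ) (0<s : 0ℚ < s) where

  private
    0<s+s : 0ℚ < s + s
    0<s+s = 0<+ 0<s (<⇒≤ 0<s)

    instance
      s+s≢0 : NonZero (s + s)
      s+s≢0 = pos⇒nonZero (s + s) {{positive 0<s+s}}

  halfInverse : ℚ
  halfInverse = 1/ (s + s)

  [halfInverse+halfInverse]*s≡1 : (halfInverse + halfInverse) * s ≡ 1ℚ
  [halfInverse+halfInverse]*s≡1 = trans (solve 2 (λ p s → (p :+ p) :* s := p :* (s :+ s)) refl halfInverse s) (*-inverseˡ (s + s))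

  0<halfInverse : 0ℚ < halfInverse
  0<halfInverse = positive⁻¹ halfInverse {{1/pos⇒pos (s + s) {{positive 0<s+s}}}}

[p+p]*s≡1⇒p≤1 : ∀ {p s} → 0ℚ < p → ½ < s → (p + p) * s ≡ 1ℚ → p ≤ 1ℚ
[p+p]*s≡1⇒p≤1 {p} {s} 0<p ½<s [p+p]*s≡1 = begin
  p               ≡⟨ solve 1 (λ p → p := (p :+ p) :* con ½) refl p ⟩
  (p + p) * ½     ≤⟨ *-monoʳ-≤ (0≤+ (<⇒≤ 0<p) (<⇒≤ 0<p)) (<⇒≤ ½<s) ⟩
  (p + p) * s     ≡⟨ [p+p]*s≡1 ⟩
  1ℚ              ∎
  where open ≤-Reasoning

½<p⇒s<1 : ∀ {p s} → 0ℚ < s → ½ < p → (p + p) * s ≡ 1ℚ → s < 1ℚ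
½<p⇒s<1 {p} {s} 0<s ½<p [p+p]*s≡1 = *-cancelˡ-< {1ℚ} (≤ᵇ⇒≤ _) (begin-strict
  1ℚ * s          <⟨ *-monoˡ-< 0<s (+-mono-< ½<p ½<p) ⟩
  (p + p) * s     ≡⟨ [p+p]*s≡1 ⟩
  1ℚ              ≡⟨ *-identityʳ 1ℚ ⟨
  1ℚ * 1ℚ         ∎)
  where open ≤-Reasoning

half-inverse-scale : ∀ {p s p′ s′ k c} → (p + p) * s ≡ 1ℚ → (p′ + p′) * s′ ≡ 1ℚ → k * s′ ≡ c * s → p * k ≡ p′ * c
half-inverse-scale {p} {s} {p′} {s′} {k} {c} [p+p]*s≡1 [p′+p′]*s′≡1 ks′≡cs = begin
  p * k                              ≡⟨ *-identityʳ (p * k) ⟨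
  p * k * 1ℚ                         ≡⟨ cong (p * k *_) [p′+p′]*s′≡1 ⟨
  p * k * ((p′ + p′) * s′)           ≡⟨ solve 5 (λ p k q s′ s → p :* k :* ((q :+ q) :* s′) := (p :+ p) :* q :* (k :* s′)) refl p k p′ s′ s ⟩
  (p + p) * p′ * (k * s′)            ≡⟨ cong ((p + p) * p′ *_) ks′≡cs ⟩
  (p + p) * p′ * (c * s)             ≡⟨ solve 4 (λ p q c s → (p :+ p) :* q :* (c :* s) := q :* c :* ((p :+ p) :* s)) refl p p′ c s ⟩
  p′ * c * ((p + p) * s)             ≡⟨ cong (p′ * c *_) [p+p]*s≡1 ⟩
  p′ * c * 1ℚ                        ≡⟨ *-identityʳ (p′ * c) ⟩
  p′ * c                             ∎
  where open ≡-Reasoning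

module Constants (m : ℕ) where

  n : ℕ
  n = suc m

  nℚ : ℚ
  nℚ = fromℕ n

  1≤nℚ : 1ℚ ≤ nℚ
  1≤nℚ = 1≤fromℕ-suc m

  M : ℕ
  M = n ℕ.+ 10

  -- U = L + t bounds every partial sum of ln 2, hence ln 2, and exceeds L by less than 1/(1024 n).
  -- Abstract, so that the truncation depth M = n + 10 is never unfolded by the type checker.
  abstract
    L : ℚ
    L = lnTwoPartial M

    t : ℚ
    t = (+ 1 / suc M) * halfPow M

    L≡lnTwoPartial : L ≡ lnTwoPartial M
    L≡lnTwoPartial = refl

    lnTwoPartial≤L+t : ∀ N → lnTwoPartial N ≤ L + t
    lnTwoPartial≤L+t N = lnTwoPartial-upper M N

    -- lnTwoPartial 3 = 2/3 and 2/3 + 2⁻³/4 = 67/96 by computation.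
    2/3≤L : + 2 / 3 ≤ L
    2/3≤L = lnTwoPartial-mono-≤ (ℕ.≤⇒≤′ {3} {M} (ℕ.≤-trans (ℕ.s≤s (ℕ.s≤s (ℕ.s≤s ℕ.z≤n))) (ℕ.m≤n+m 10 n)))

    L≤67/96 : L ≤ + 67 / 96
    L≤67/96 = lnTwoPartial-upper 3 M

    0≤t : 0ℚ ≤ t
    0≤t = 0≤* (0≤1/n M) (0≤halfPow M)

    t*n≤2⁻¹⁰ : t * nℚ ≤ + 1 / 1024
    t*n≤2⁻¹⁰ = begin
      (+ 1 / suc M) * halfPow M * nℚ     ≡⟨ solve 3 (λ c h q → (c :* h) :* q := h :* (c :* q)) refl (+ 1 / suc M) (halfPow M) nℚ ⟩
      halfPow M * ((+ 1 / suc M) * nℚ)   ≤⟨ *-monoʳ-≤ (0≤halfPow M) (*-monoʳ-≤ (0≤1/n M) (fromℕ-mono-≤ (ℕ.≤-trans (ℕ.m≤m+n n 10) (ℕ.n≤1+n M)))) ⟩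
      halfPow M * ((+ 1 / suc M) * fromℕ (suc M)) ≡⟨ cong (halfPow M *_) (1/n*n≡1 M) ⟩
      halfPow M * 1ℚ                     ≡⟨ *-identityʳ (halfPow M) ⟩
      halfPow M                          ≤⟨ halfPow-antimono-≤ (ℕ.≤⇒≤′ (ℕ.m≤n+m 10 n)) ⟩
      + 1 / 1024                         ∎
      where open ≤-Reasoning

  t≤2⁻¹⁰ : t ≤ + 1 / 1024
  t≤2⁻¹⁰ = ≤-trans (≤-trans (≤-reflexive (sym (*-identityʳ t))) (*-monoʳ-≤ 0≤t 1≤nℚ)) t*n≤2⁻¹⁰

  U : ℚ
  U = L + t

  0≤U : 0ℚ ≤ U
  0≤U = 0≤+ (≤-trans (≤ᵇ⇒≤ _) 2/3≤L) 0≤t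

  U≤7/10 : U ≤ + 7 / 10
  U≤7/10 = ≤-trans (+-mono-≤ L≤67/96 t≤2⁻¹⁰) (≤ᵇ⇒≤ _)

  -- Slack constants: W pays for the 1/(52 n) in the ratio, ξ for the perturbation η.
  W : ℚ
  W = + 1 / 25

  ξ : ℚ
  ξ = + 1 / 100

  0<1+U : 0ℚ < 1ℚ + U
  0<1+U = 0<+ (positive⁻¹ 1ℚ) 0≤U

  instance
    1+U≢0 : NonZero (1ℚ + U)
    1+U≢0 = pos⇒nonZero (1ℚ + U) {{positive 0<1+U}}

  abstract
    K : ℚ
    K = (nℚ - W) ÷ (1ℚ + U)

    K*[1+U]≡n-W : K * (1ℚ + U) ≡ nℚ - W
    K*[1+U]≡n-W = begin
      (nℚ - W) * 1/ (1ℚ + U) * (1ℚ + U)   ≡⟨ *-assoc (nℚ - W) (1/ (1ℚ + U)) (1ℚ + U) ⟩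
      (nℚ - W) * (1/ (1ℚ + U) * (1ℚ + U)) ≡⟨ cong ((nℚ - W) *_) (*-inverseˡ (1ℚ + U)) ⟩
      (nℚ - W) * 1ℚ                       ≡⟨ *-identityʳ (nℚ - W) ⟩
      nℚ - W                              ∎
      where open ≡-Reasoning

    0≤K : 0ℚ ≤ K
    0≤K = 0≤* (p≤q⇒0≤q-p {W} (≤-trans (≤ᵇ⇒≤ _) 1≤nℚ)) (<⇒≤ (positive⁻¹ _ {{1/pos⇒pos (1ℚ + U) {{positive 0<1+U}}}}))

  n≡K+K*U+W : nℚ ≡ K + K * U + W
  n≡K+K*U+W = begin
    nℚ                 ≡⟨ solve 2 (λ q w → q := (q :- w) :+ w) refl nℚ W ⟩
    (nℚ - W) + W       ≡⟨ cong (_+ W) K*[1+U]≡n-W ⟨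
    K * (1ℚ + U) + W   ≡⟨ solve 3 (λ k u w → k :* (con 1ℚ :+ u) :+ w := k :+ k :* u :+ w) refl K U W ⟩
    K + K * U + W      ∎
    where open ≡-Reasoning

  14/25≤K : + 14 / 25 ≤ K
  14/25≤K = *-cancelˡ-≤ (positive⁻¹ (+ 17 / 10)) (begin
    (+ 17 / 10) * (+ 14 / 25)  ≤⟨ ≤ᵇ⇒≤ _ ⟩
    1ℚ - W                     ≤⟨ +-monoˡ-≤ (- W) 1≤nℚ ⟩
    nℚ - W                     ≡⟨ K*[1+U]≡n-W ⟨
    K * (1ℚ + U)               ≤⟨ *-monoʳ-≤ 0≤K (+-monoʳ-≤ 1ℚ U≤7/10) ⟩
    K * (+ 17 / 10)            ≡⟨ *-comm K _ ⟩
    (+ 17 / 10) * K            ∎)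
    where open ≤-Reasoning

  0<K : 0ℚ < K
  0<K = <-≤-trans (positive⁻¹ (+ 14 / 25)) 14/25≤K

  K≤n : K ≤ nℚ
  K≤n = ≤-trans (≤-by-gap (K * U + W) (+-assoc K (K * U) W) (0≤+ (0≤* 0≤K 0≤U) (≤ᵇ⇒≤ _))) (≤-reflexive (sym n≡K+K*U+W))

  [K+1/52]*[1+U]≤n : (K + + 1 / 52) * (1ℚ + U) ≤ nℚ
  [K+1/52]*[1+U]≤n = begin
    (K + + 1 / 52) * (1ℚ + U)
      ≡⟨ solve 3 (λ k u w → (k :+ con (+ 1 / 52)) :* (con 1ℚ :+ u) := (k :+ k :* u :+ w) :+ (con (+ 1 / 52) :* (con 1ℚ :+ u) :- w)) refl K U W ⟩
    (K + K * U + W) + ((+ 1 / 52) * (1ℚ + U) - W)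
      ≤⟨ +-monoʳ-≤ (K + K * U + W) (≤-trans (+-monoˡ-≤ (- W) (*-monoʳ-≤ {+ 1 / 52} (≤ᵇ⇒≤ _) (+-monoʳ-≤ 1ℚ U≤7/10))) (≤ᵇ⇒≤ _)) ⟩
    (K + K * U + W) + 0ℚ
      ≡⟨ trans (+-identityʳ _) (sym n≡K+K*U+W) ⟩
    nℚ ∎
    where open ≤-Reasoning

  eps*n≡1/52 : eps n * nℚ ≡ + 1 / 52
  eps*n≡1/52 = begin
    eps n * nℚ                                ≡⟨ solve 2 (λ e q → e :* q := (e :* (con (+ 52 / 1) :* q)) :* con (+ 1 / 52)) refl (eps n) nℚ ⟩
    (eps n * (fromℕ 52 * nℚ)) * (+ 1 / 52)    ≡⟨ cong (λ x → (eps n * x) * (+ 1 / 52)) (fromℕ-* 52 n) ⟨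
    (eps n * fromℕ (52 ℕ.* n)) * (+ 1 / 52)   ≡⟨ cong (_* (+ 1 / 52)) (1/n*n≡1 (m ℕ.+ 51 ℕ.* n)) ⟩
    1ℚ * (+ 1 / 52)                           ≡⟨ *-identityˡ _ ⟩
    + 1 / 52                                  ∎
    where open ≡-Reasoning

  abstract
    η : ℚ
    η = (+ 1 / 600) * ((+ 1 / n) * (+ 1 / n))

    0<η : 0ℚ < η
    0<η = 0<* (positive⁻¹ (+ 1 / 600)) (0<* 0<1/n 0<1/n)
      where
      0<1/n : 0ℚ < + 1 / n
      0<1/n = positive⁻¹ _ {{normalize-pos 1 n}}

    η≤1 : η ≤ 1ℚ
    η≤1 = ≤-trans (*-monoʳ-≤ {+ 1 / 600} (≤ᵇ⇒≤ _) (*-mono-≤ (0≤1/n m) 1/n≤1 (0≤1/n m) 1/n≤1)) (≤ᵇ⇒≤ _)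
      where
      1/n≤1 : + 1 / n ≤ 1ℚ
      1/n≤1 = 1/n-antimono-≤ {0} {m} ℕ.z≤n

    n*n*η≡1/600 : nℚ * nℚ * η ≡ + 1 / 600
    n*n*η≡1/600 = begin
      nℚ * nℚ * ((+ 1 / 600) * (r * r))        ≡⟨ solve 2 (λ q r → q :* q :* (con (+ 1 / 600) :* (r :* r)) := con (+ 1 / 600) :* ((r :* q) :* (r :* q))) refl nℚ r ⟩
      (+ 1 / 600) * ((r * nℚ) * (r * nℚ))      ≡⟨ cong (λ x → (+ 1 / 600) * (x * x)) (1/n*n≡1 m) ⟩
      (+ 1 / 600) * (1ℚ * 1ℚ)                  ≡⟨⟩
      + 1 / 600                                ∎
      where
      open ≡-Reasoning
      r : ℚ
      r = + 1 / n

  0≤η : 0ℚ ≤ η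
  0≤η = <⇒≤ 0<η

  budget : ℚ → ℚ
  budget x = (x - K) * (K + K + 1ℚ) + + 1 / 4 + ξ

  Γ : ℚ
  Γ = (K + K) * (K + 1ℚ)

  0≤2K+1 : 0ℚ ≤ K + K + 1ℚ
  0≤2K+1 = 0≤+ (0≤+ 0≤K 0≤K) (≤ᵇ⇒≤ _)

  0≤K+1 : 0ℚ ≤ K + 1ℚ
  0≤K+1 = 0≤+ 0≤K (≤ᵇ⇒≤ _)

  0≤Γ : 0ℚ ≤ Γ
  0≤Γ = 0≤* (0≤+ 0≤K 0≤K) 0≤K+1

  budget-+ : ∀ x a → budget (x + a) ≡ budget x + a * (K + K + 1ℚ)
  budget-+ x a = solve 5 (λ x a k c ξ → ((x :+ a) :- k) :* (k :+ k :+ con 1ℚ) :+ c :+ ξ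
                                     := (x :- k) :* (k :+ k :+ con 1ℚ) :+ c :+ ξ :+ a :* (k :+ k :+ con 1ℚ))
                          refl x a K (+ 1 / 4) ξ

  budget-mono-≤ : ∀ {x y} → x ≤ y → budget x ≤ budget y
  budget-mono-≤ x≤y = +-monoˡ-≤ ξ (+-monoˡ-≤ (+ 1 / 4) (*-monoˡ-≤ 0≤2K+1 (+-monoˡ-≤ (- K) x≤y)))

  η-perturbation≤ξ : ∀ {A} → 0ℚ ≤ A → A ≤ nℚ → (K + 1ℚ) * A * (η * (+ 2 / 1 + η)) ≤ ξ
  η-perturbation≤ξ {A} 0≤A A≤n = begin
    (K + 1ℚ) * A * (η * (+ 2 / 1 + η))
      ≤⟨ *-mono-≤ (0≤* 0≤K+1 0≤A) (*-mono-≤ 0≤K+1 (+-mono-≤ K≤n 1≤nℚ) 0≤A A≤n)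
                  (0≤* 0≤η (0≤+ {+ 2 / 1} (≤ᵇ⇒≤ _) 0≤η)) (*-monoʳ-≤ 0≤η (+-monoʳ-≤ (+ 2 / 1) η≤1)) ⟩
    (nℚ + nℚ) * nℚ * (η * (+ 2 / 1 + 1ℚ))
      ≡⟨ solve 2 (λ q e → (q :+ q) :* q :* (e :* (con (+ 2 / 1) :+ con 1ℚ)) := con (+ 6 / 1) :* (q :* q :* e)) refl nℚ η ⟩
    (+ 6 / 1) * (nℚ * nℚ * η)
      ≡⟨ cong ((+ 6 / 1) *_) n*n*η≡1/600 ⟩
    ξ ∎
    where open ≤-Reasoning

  -- Without the perturbation η the gap is K (A - K - ½)² + (A - K) / 4; the η-terms cost at most ξ.
  first-round-budget : ∀ {A} → K < A → A ≤ nℚ →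
    (K + 1ℚ) * ((A * (1ℚ + η)) * (A * (1ℚ + η)) - K * K) ≤ (A * (1ℚ + η)) * budget A
  first-round-budget {A} K<A A≤n = ≤-by-gap gap
    (solve 4 (λ K A η ξ →
       (A :* (con 1ℚ :+ η)) :* ((A :- K) :* (K :+ K :+ con 1ℚ) :+ con (+ 1 / 4) :+ ξ)
       := (K :+ con 1ℚ) :* ((A :* (con 1ℚ :+ η)) :* (A :* (con 1ℚ :+ η)) :- K :* K)
          :+ (K :* (((A :- K) :- con ½) :* ((A :- K) :- con ½)) :+ (A :- K) :* con (+ 1 / 4)
              :+ A :* η :* ((A :- K) :* (K :+ K :+ con 1ℚ) :+ con (+ 1 / 4) :+ ξ)
              :+ A :* (ξ :- (K :+ con 1ℚ) :* A :* (η :* (con (+ 2 / 1) :+ η))))) refl K A η ξ)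
    (0≤+ (0≤+ (0≤+ (0≤* 0≤K (0≤p*p (θ - ½))) (0≤* 0≤θ (≤ᵇ⇒≤ _)))
              (0≤* (0≤* 0≤A 0≤η) 0≤budget))
         (0≤* 0≤A (p≤q⇒0≤q-p (η-perturbation≤ξ 0≤A A≤n))))
    where
    θ = A - K
    gap = K * ((θ - ½) * (θ - ½)) + θ * (+ 1 / 4) + A * η * budget A
          + A * (ξ - (K + 1ℚ) * A * (η * (+ 2 / 1 + η)))
    0≤A = ≤-trans 0≤K (<⇒≤ K<A)
    0≤θ = p≤q⇒0≤q-p (<⇒≤ K<A)
    0≤budget : 0ℚ ≤ budget A
    0≤budget = 0≤+ (0≤+ (0≤* 0≤θ 0≤2K+1) (≤ᵇ⇒≤ _)) (≤ᵇ⇒≤ _)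

  round-budget : ∀ {a} → 1ℚ ≤ a → (K + 1ℚ) * ((K + a) * (K + a) - K * K) ≤ (K + a) * (a * (K + K + 1ℚ))
  round-budget {a} 1≤a = ≤-by-gap (a * K * (a - 1ℚ))
    (solve 2 (λ K a → (K :+ a) :* (a :* (K :+ K :+ con 1ℚ)) := (K :+ con 1ℚ) :* ((K :+ a) :* (K :+ a) :- K :* K) :+ a :* K :* (a :- con 1ℚ)) refl K a)
    (0≤* (0≤* (≤-trans (≤ᵇ⇒≤ _) 1≤a) 0≤K) (p≤q⇒0≤q-p 1≤a))

  budget-n<Γ*L : budget nℚ < Γ * L
  budget-n<Γ*L = <-by-gap (K * X - (W + + 1 / 4 + ξ))
    (trans (solve 5 (λ K L t W ξ →
              (K :+ K) :* (K :+ con 1ℚ) :* L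
              := ((K :+ K :* (L :+ t) :+ W) :- K) :* (K :+ K :+ con 1ℚ) :+ con (+ 1 / 4) :+ ξ
                 :+ (K :* (L :- (t :* K :+ t :* K :+ t :+ (W :+ W))) :- (W :+ con (+ 1 / 4) :+ ξ))) refl K L t W ξ)
           (cong (λ q → (q - K) * (K + K + 1ℚ) + + 1 / 4 + ξ + (K * X - (W + + 1 / 4 + ξ))) (sym n≡K+K*U+W)))
    (<-≤-trans (positive⁻¹ (+ 8 / 300)) (+-monoˡ-≤ (- (W + + 1 / 4 + ξ)) 98/300≤K*X))
    where
    X = L - (t * K + t * K + t + (W + W))
    t*K≤2⁻¹⁰ : t * K ≤ + 1 / 1024
    t*K≤2⁻¹⁰ = ≤-trans (*-monoʳ-≤ 0≤t K≤n) t*n≤2⁻¹⁰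
    7/12≤X : + 7 / 12 ≤ X
    7/12≤X = ≤-trans (≤ᵇ⇒≤ _) (+-mono-≤ 2/3≤L (neg-antimono-≤
      (+-mono-≤ (+-mono-≤ (+-mono-≤ t*K≤2⁻¹⁰ t*K≤2⁻¹⁰) t≤2⁻¹⁰) (≤-refl {W + W}))))
    98/300≤K*X : + 98 / 300 ≤ K * X
    98/300≤K*X = ≤-trans (≤ᵇ⇒≤ _) (*-mono-≤ {+ 14 / 25} (≤ᵇ⇒≤ _) 14/25≤K (≤ᵇ⇒≤ _) 7/12≤X)

  lnTwoPartial≤U : ∀ N → lnTwoPartial N ≤ U
  lnTwoPartial≤U = lnTwoPartial≤L+t

  atMostRatio : ∀ {d s} → 0ℚ ≤ d → 0ℚ ≤ s → d ≤ K * s → AtMostRatio n d (nℚ * s)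
  atMostRatio {d} {s} 0≤d 0≤s d≤K*s q (N , q<Sₙ) = begin
    (d + eps n * (nℚ * s)) * (1ℚ + q)  ≤⟨ *-monoʳ-≤ (0≤+ 0≤d (≤-trans (0≤* {+ 1 / 52} (≤ᵇ⇒≤ _) 0≤s) (≤-reflexive (sym eps*n*s≡s/52))))
                                                    (+-monoʳ-≤ 1ℚ (≤-trans (<⇒≤ q<Sₙ) (lnTwoPartial≤U N))) ⟩
    (d + eps n * (nℚ * s)) * (1ℚ + U)  ≤⟨ *-monoˡ-≤ (<⇒≤ 0<1+U) (+-mono-≤ d≤K*s (≤-reflexive eps*n*s≡s/52)) ⟩
    (K * s + (+ 1 / 52) * s) * (1ℚ + U) ≡⟨ solve 3 (λ k s u → (k :* s :+ con (+ 1 / 52) :* s) :* (con 1ℚ :+ u) := s :* ((k :+ con (+ 1 / 52)) :* (con 1ℚ :+ u))) refl K s U ⟩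
    s * ((K + + 1 / 52) * (1ℚ + U))    ≤⟨ *-monoʳ-≤ 0≤s [K+1/52]*[1+U]≤n ⟩
    s * nℚ                             ≡⟨ *-comm s nℚ ⟩
    nℚ * s                             ∎
    where
    open ≤-Reasoning
    eps*n*s≡s/52 : eps n * (nℚ * s) ≡ (+ 1 / 52) * s
    eps*n*s≡s/52 = trans (sym (*-assoc (eps n) nℚ s)) (cong (_* s) eps*n≡1/52)

  Φ : ℚ → ℚ
  Φ p = Γ * logSeries M (1ℚ - p)

  Φ-increment : ∀ {B p p′} → K ≤ B → p * K ≡ p′ * B → 0ℚ ≤ p′ → p′ ≤ p → p ≤ 1ℚ →
    B * (Φ p′ - Φ p) ≤ (K + 1ℚ) * (B * B - K * K)
  Φ-increment {B} {p} {p′} K≤B pK≡p′B 0≤p′ p′≤p p≤1 = begin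
    B * (Φ p′ - Φ p)                  ≡⟨ solve 4 (λ K B F F′ → B :* ((K :+ K) :* (K :+ con 1ℚ) :* F′ :- (K :+ K) :* (K :+ con 1ℚ) :* F)
                                                          := (K :+ con 1ℚ) :* ((K :* B) :* ((F′ :- F) :+ (F′ :- F)))) refl K B F F′ ⟩
    (K + 1ℚ) * ((K * B) * (Δ + Δ))    ≤⟨ *-monoʳ-≤ 0≤K+1 (logSeries-increment M 0≤K K≤B pK≡p′B 0≤p′ p′≤p p≤1) ⟩
    (K + 1ℚ) * (B * B - K * K)        ∎
    where
    open ≤-Reasoning
    F = logSeries M (1ℚ - p)
    F′ = logSeries M (1ℚ - p′)
    Δ = F′ - F

  Φ-round : ∀ {x a p p′} → 1ℚ ≤ a → p * K ≡ p′ * (K + a) → 0ℚ < p′ → p ≤ 1ℚ → Φ p ≤ budget x → Φ p′ ≤ budget (x + a)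
  Φ-round {x} {a} {p} {p′} 1≤a pK≡p′[K+a] 0<p′ p≤1 Φp≤budget = begin
    Φ p′                                ≡⟨ solve 2 (λ f f′ → f′ := f :+ (f′ :- f)) refl (Φ p) (Φ p′) ⟩
    Φ p + (Φ p′ - Φ p)                  ≤⟨ +-mono-≤ Φp≤budget ΔΦ≤ ⟩
    budget x + a * (K + K + 1ℚ)         ≡⟨ budget-+ x a ⟨
    budget (x + a)                      ∎
    where
    open ≤-Reasoning
    0≤a = ≤-trans (≤ᵇ⇒≤ _) 1≤a
    K≤K+a = ≤-by-gap a refl 0≤a
    p′≤p : p′ ≤ p
    p′≤p = *-cancelˡ-≤ 0<K (begin
      K * p′         ≤⟨ *-monoˡ-≤ (<⇒≤ 0<p′) K≤K+a ⟩
      (K + a) * p′   ≡⟨ trans (*-comm (K + a) p′) (sym pK≡p′[K+a]) ⟩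
      p * K          ≡⟨ *-comm p K ⟩
      K * p          ∎)
    ΔΦ≤ : Φ p′ - Φ p ≤ a * (K + K + 1ℚ)
    ΔΦ≤ = *-cancelˡ-≤ (<-≤-trans 0<K K≤K+a) (begin
      (K + a) * (Φ p′ - Φ p)                     ≤⟨ Φ-increment K≤K+a pK≡p′[K+a] (<⇒≤ 0<p′) p′≤p p≤1 ⟩
      (K + 1ℚ) * ((K + a) * (K + a) - K * K)     ≤⟨ round-budget 1≤a ⟩
      (K + a) * (a * (K + K + 1ℚ))               ∎)

  Φ-first-round : ∀ {A p′} → K < A → A ≤ nℚ → 1ℚ * K ≡ p′ * (A * (1ℚ + η)) → 0ℚ < p′ → Φ p′ ≤ budget A
  Φ-first-round {A} {p′} K<A A≤n K≡p′B 0<p′ = *-cancelˡ-≤ 0<B (begin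
    B * Φ p′                           ≡⟨ cong (B *_) (solve 2 (λ f g → f := f :- g :* con 0ℚ) refl (Φ p′) Γ) ⟩
    B * (Φ p′ - Γ * 0ℚ)                ≡⟨ cong (λ f → B * (Φ p′ - Γ * f)) (trans (cong (logSeries M) (+-inverseʳ 1ℚ)) (logSeries-0 M)) ⟨
    B * (Φ p′ - Φ 1ℚ)                  ≤⟨ Φ-increment K≤B K≡p′B (<⇒≤ 0<p′) p′≤1 ≤-refl ⟩
    (K + 1ℚ) * (B * B - K * K)         ≤⟨ first-round-budget K<A A≤n ⟩
    B * budget A                       ∎)
    where
    open ≤-Reasoning
    B = A * (1ℚ + η)
    K≤B : K ≤ B
    K≤B = ≤-trans (<⇒≤ K<A) (≤-by-gap (A * η) (solve 2 (λ a e → a :* (con 1ℚ :+ e) := a :+ a :* e) refl A η)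
                                       (0≤* (≤-trans 0≤K (<⇒≤ K<A)) 0≤η))
    0<B = <-≤-trans 0<K K≤B
    p′≤1 : p′ ≤ 1ℚ
    p′≤1 = *-cancelˡ-≤ 0<B (begin
      B * p′     ≡⟨ trans (*-comm B p′) (sym K≡p′B) ⟩
      1ℚ * K     ≤⟨ *-monoʳ-≤ {1ℚ} (≤ᵇ⇒≤ _) K≤B ⟩
      1ℚ * B     ≡⟨ *-comm 1ℚ B ⟩
      B * 1ℚ     ∎)

  ½<p : ∀ {p} → Φ p < Γ * L → ½ < p
  ½<p {p} Φp<ΓL with p ≤? ½
  ... | no p≰½ = ≰⇒> p≰½
  ... | yes p≤½ = ⊥-elim (<-irrefl refl (begin-strict
    Γ * L                       ≡⟨ cong (Γ *_) (trans L≡lnTwoPartial (sym (logSeries-½ M))) ⟩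
    Γ * logSeries M ½           ≤⟨ *-monoʳ-≤ 0≤Γ (logSeries-mono-≤ M (≤ᵇ⇒≤ _) ½≤1-p) ⟩
    Φ p                         <⟨ Φp<ΓL ⟩
    Γ * L                       ∎))
    where
    open ≤-Reasoning
    ½≤1-p : ½ ≤ 1ℚ - p
    ½≤1-p = ≤-by-gap (½ - p) (solve 1 (λ p → con 1ℚ :- p := con ½ :+ (con ½ :- p)) refl p) (p≤q⇒0≤q-p p≤½)

  instance
    K≢0 : NonZero K
    K≢0 = pos⇒nonZero K {{positive 0<K}}

  K*[x÷K]≡x : ∀ x → K * (x ÷ K) ≡ x
  K*[x÷K]≡x x = begin
    K * (x * 1/ K)    ≡⟨ solve 3 (λ k x i → k :* (x :* i) := x :* (k :* i)) refl K x (1/ K) ⟩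
    x * (K * 1/ K)    ≡⟨ cong (x *_) (*-inverseʳ K) ⟩
    x * 1ℚ            ≡⟨ *-identityʳ x ⟩
    x                 ∎
    where open ≡-Reasoning

  s₀ : ℚ
  s₀ = (1ℚ + η) * ½

  ½<s₀ : ½ < s₀
  ½<s₀ = <-by-gap (η * ½) (solve 1 (λ e → (con 1ℚ :+ e) :* con ½ := con ½ :+ e :* con ½) refl η) (0<* 0<η (positive⁻¹ ½))

  s₀≤1 : s₀ ≤ 1ℚ
  s₀≤1 = ≤-trans (*-monoˡ-≤ {½} (≤ᵇ⇒≤ _) (+-monoʳ-≤ 1ℚ η≤1)) (≤ᵇ⇒≤ _)

module Adversary {m : ℕ} (A : OnlineAlg (suc m)) (legal : Legal A) where

  open Constants m

  Outcome : Set
  Outcome = Σ (List ℚ) λ σ → ValidInput σ × Σ ℚ λ o → IsOPT n σ o × (0ℚ < o) × AtMostRatio n (algValue A σ) o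

  block : List ℚ → ℚ → Assignment n
  block σ s = zip (replicate n s) (decisionsFrom A σ (replicate n s))

  algValue-++-replicate : ∀ σ s → algValue A (σ ++ replicate n s) ≡ algValue A σ + fromℕ (accepted (block σ s)) * s
  algValue-++-replicate σ s = begin
    value (run A (σ ++ replicate n s))   ≡⟨ cong value (run-++ A σ (replicate n s)) ⟩
    value (run A σ ++ block σ s)         ≡⟨ value-++ (run A σ) (block σ s) ⟩
    algValue A σ + value (block σ s)     ≡⟨ cong (_+_ (algValue A σ)) (value-replicate s n (decisionsFrom A σ (replicate n s))) ⟩
    algValue A σ + fromℕ (accepted (block σ s)) * s ∎
    where open ≡-Reasoning

  accepted-++-replicate : ∀ σ s → accepted (run A (σ ++ replicate n s)) ≡ accepted (run A σ) ℕ.+ accepted (block σ s)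
  accepted-++-replicate σ s = trans (cong accepted (run-++ A σ (replicate n s))) (accepted-++ (run A σ) (block σ s))

  Large≤⇒Valid : ∀ {σ s} → s ≤ 1ℚ → All (Large≤ s) σ → ValidInput σ
  Large≤⇒Valid s≤1 = All.map (λ (½<x , x≤s) → <-trans 0<½ ½<x , ≤-trans x≤s s≤1)

  Large≤-++-replicate : ∀ {σ s} → ½ < s → All (Large≤ s) σ → All (Large≤ s) (σ ++ replicate n s)
  Large≤-++-replicate ½<s items = ++⁺ items (replicate⁺ n (½<s , ≤-refl))

  Large≤-mono : ∀ {σ s s′} → s ≤ s′ → All (Large≤ s) σ → All (Large≤ s′) σ
  Large≤-mono s≤s′ = All.map (λ (½<x , x≤s) → ½<x , ≤-trans x≤s s≤s′)

  accepted-run≤n : ∀ {σ s} → All (Large≤ s) σ → ValidInput σ → accepted (run A σ) ℕ.≤ n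
  accepted-run≤n {σ} items valid = accepted≤n (run A σ) (All.map proj₁ (All-zip σ (decisions A σ) items)) (legal σ valid)

  0≤algValue : ∀ {σ s} → All (Large≤ s) σ → 0ℚ ≤ algValue A σ
  0≤algValue {σ} items = 0≤value (run A σ) (All.map (λ (½<x , _) → <⇒≤ (<-trans 0<½ ½<x)) (All-zip σ (decisions A σ) items))

  stop : ∀ σ {s} → ½ < s → s ≤ 1ℚ → All (Large≤ s) σ → algValue A (σ ++ replicate n s) ≤ K * s → Outcome
  stop σ {s} ½<s s≤1 items stopped =
    σ ++ replicate n s , Large≤⇒Valid s≤1 items′ , nℚ * s , IsOPT-++-replicate n σ ½<s s≤1 items ,
    0<* (<-≤-trans (positive⁻¹ 1ℚ) 1≤nℚ) 0<s , atMostRatio (0≤algValue items′) (<⇒≤ 0<s) stopped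
    where
    items′ = Large≤-++-replicate ½<s items
    0<s = <-trans 0<½ ½<s

  record Round : Set where
    field
      σ : List ℚ
      s p : ℚ
      N : ℕ
      items : All (Large≤ s) σ
      valid : ValidInput σ
      ½<s : ½ < s
      value≡K*s : algValue A σ ≡ K * s
      accepted≡N : accepted (run A σ) ≡ N
      [p+p]*s≡1 : (p + p) * s ≡ 1ℚ
      0<p : 0ℚ < p
      potential : Φ p ≤ budget (fromℕ N)

    0<s : 0ℚ < s
    0<s = <-trans 0<½ ½<s

    p≤1 : p ≤ 1ℚ
    p≤1 = [p+p]*s≡1⇒p≤1 0<p ½<s [p+p]*s≡1

    N≤n : N ℕ.≤ n
    N≤n = subst (ℕ._≤ n) accepted≡N (accepted-run≤n items valid)

    s<1 : s < 1ℚ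
    s<1 = ½<p⇒s<1 0<s (½<p {p} Φp<ΓL) [p+p]*s≡1
      where
      Φp<ΓL : Φ p < Γ * L
      Φp<ΓL = ≤-<-trans (≤-trans potential (budget-mono-≤ (fromℕ-mono-≤ N≤n))) budget-n<Γ*L

    algValue-after-block : algValue A (σ ++ replicate n s) ≡ (K + fromℕ (accepted (block σ s))) * s
    algValue-after-block = begin
      algValue A (σ ++ replicate n s)                   ≡⟨ algValue-++-replicate σ s ⟩
      algValue A σ + fromℕ (accepted (block σ s)) * s   ≡⟨ cong (_+ fromℕ (accepted (block σ s)) * s) value≡K*s ⟩
      K * s + fromℕ (accepted (block σ s)) * s          ≡⟨ *-distribʳ-+ s K _ ⟨
      (K + fromℕ (accepted (block σ s))) * s            ∎
      where open ≡-Reasoning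

  open Round

  nextRound : (r : Round) → K * s r < algValue A (σ r ++ replicate n (s r)) → Σ Round λ r′ → N r ℕ.< N r′
  nextRound r K*s<V′ with accepted (block (σ r) (s r)) in a≡
  ... | zero = ⊥-elim (<-irrefl (sym V′≡K*s) K*s<V′)
    where
    V′≡K*s : algValue A (σ r ++ replicate n (s r)) ≡ K * s r
    V′≡K*s = trans (algValue-after-block r) (trans (cong (λ a → (K + fromℕ a) * s r) a≡) (cong (_* s r) (+-identityʳ K)))
  ... | suc a₀ = record
    { σ = σ′ ; s = s′ ; p = p′ ; N = N r ℕ.+ a
    ; items = Large≤-mono (<⇒≤ s<s′) items′
    ; valid = Large≤⇒Valid (<⇒≤ (s<1 r)) items′
    ; ½<s = <-trans (½<s r) s<s′
    ; value≡K*s = sym (K*[x÷K]≡x V′)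
    ; accepted≡N = trans (accepted-++-replicate (σ r) (s r)) (cong₂ ℕ._+_ (accepted≡N r) a≡)
    ; [p+p]*s≡1 = [p′+p′]*s′≡1
    ; 0<p = 0<p′
    ; potential = Φp′≤budget
    } , ℕ.m<m+n (N r) (ℕ.s≤s ℕ.z≤n)
    where
    a = suc a₀
    σ′ = σ r ++ replicate n (s r)
    V′ = algValue A σ′
    items′ = Large≤-++-replicate (½<s r) (items r)
    V′≡[K+a]*s : V′ ≡ (K + fromℕ a) * s r
    V′≡[K+a]*s = trans (algValue-after-block r) (cong (λ a → (K + fromℕ a) * s r) a≡)
    s′ = V′ ÷ K
    K*s′≡V′ = K*[x÷K]≡x V′
    s<s′ : s r < s′
    s<s′ = *-cancelˡ-< 0≤K (<-≤-trans K*s<V′ (≤-reflexive (sym K*s′≡V′)))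
    0<s′ = <-trans (0<s r) s<s′
    p′ = halfInverse s′ 0<s′
    [p′+p′]*s′≡1 = [halfInverse+halfInverse]*s≡1 s′ 0<s′
    0<p′ = 0<halfInverse s′ 0<s′
    pK≡p′[K+a] : p r * K ≡ p′ * (K + fromℕ a)
    pK≡p′[K+a] = half-inverse-scale {p r} {s r} {p′} {s′} {K} {K + fromℕ a} ([p+p]*s≡1 r) [p′+p′]*s′≡1 (trans K*s′≡V′ V′≡[K+a]*s)
    Φp′≤budget : Φ p′ ≤ budget (fromℕ (N r ℕ.+ a))
    Φp′≤budget = subst (λ x → Φ p′ ≤ budget x) (sym (fromℕ-+ (N r) a))
      (Φ-round {fromℕ (N r)} {fromℕ a} {p r} {p′} (1≤fromℕ-suc a₀) pK≡p′[K+a] 0<p′ (p≤1 r) (potential r))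

  firstRound : K * s₀ < algValue A (replicate n s₀) → Round
  firstRound K*s₀<V = record
    { σ = σ₀ ; s = s₁ ; p = p₁ ; N = a
    ; items = Large≤-mono (<⇒≤ s₀<s₁) items₀
    ; valid = Large≤⇒Valid s₀≤1 items₀
    ; ½<s = <-trans ½<s₀ s₀<s₁
    ; value≡K*s = sym K*s₁≡V
    ; accepted≡N = refl
    ; [p+p]*s≡1 = [p₁+p₁]*s₁≡1
    ; 0<p = 0<p₁
    ; potential = Φ-first-round {fromℕ a} {p₁} K<a (fromℕ-mono-≤ (accepted-run≤n items₀ (Large≤⇒Valid s₀≤1 items₀))) K≡p₁B 0<p₁
    }
    where
    σ₀ = replicate n s₀
    items₀ : All (Large≤ s₀) σ₀
    items₀ = replicate⁺ n (½<s₀ , ≤-refl)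
    a = accepted (run A σ₀)
    V = algValue A σ₀
    V≡a*s₀ : V ≡ fromℕ a * s₀
    V≡a*s₀ = value-replicate s₀ n (decisions A σ₀)
    0<s₀ = <-trans 0<½ ½<s₀
    K<a : K < fromℕ a
    K<a = *-cancelˡ-< (<⇒≤ 0<s₀) (begin-strict
      s₀ * K         ≡⟨ *-comm s₀ K ⟩
      K * s₀         <⟨ K*s₀<V ⟩
      V              ≡⟨ trans V≡a*s₀ (*-comm (fromℕ a) s₀) ⟩
      s₀ * fromℕ a   ∎)
      where open ≤-Reasoning
    s₁ = V ÷ K
    K*s₁≡V = K*[x÷K]≡x V
    s₀<s₁ : s₀ < s₁
    s₀<s₁ = *-cancelˡ-< 0≤K (<-≤-trans K*s₀<V (≤-reflexive (sym K*s₁≡V)))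
    0<s₁ = <-trans 0<s₀ s₀<s₁
    p₁ = halfInverse s₁ 0<s₁
    [p₁+p₁]*s₁≡1 = [halfInverse+halfInverse]*s≡1 s₁ 0<s₁
    0<p₁ = 0<halfInverse s₁ 0<s₁
    K≡p₁B : 1ℚ * K ≡ p₁ * (fromℕ a * (1ℚ + η))
    K≡p₁B = half-inverse-scale {1ℚ} {½} {p₁} {s₁} {K} {fromℕ a * (1ℚ + η)} refl [p₁+p₁]*s₁≡1
      (trans K*s₁≡V (trans V≡a*s₀ (sym (*-assoc (fromℕ a) (1ℚ + η) ½))))

  play : (fuel : ℕ) (r : Round) → n ℕ.< fuel ℕ.+ N r → Outcome
  play zero r n<N = ⊥-elim (ℕ.<⇒≱ n<N (N≤n r))
  play (suc fuel) r n<1+fuel+N with algValue A (σ r ++ replicate n (s r)) ≤? K * s r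
  ... | yes stopped = stop (σ r) (½<s r) (<⇒≤ (s<1 r)) (items r) stopped
  ... | no continue with nextRound r (≰⇒> continue)
  ...   | r′ , N<N′ = play fuel r′ (ℕ.<-≤-trans n<1+fuel+N (subst (ℕ._≤ fuel ℕ.+ N r′) (ℕ.+-suc fuel (N r)) (ℕ.+-monoʳ-≤ fuel N<N′)))

  outcome : Outcome
  outcome with algValue A (replicate n s₀) ≤? K * s₀
  ... | yes stopped = stop [] ½<s₀ s₀≤1 [] stopped
  ... | no continue = play (suc n) (firstRound (≰⇒> continue)) (ℕ.s≤s (ℕ.m≤m+n n _))

theorem28 : (n : ℕ) → n ≥ 1 → (A : OnlineAlg n) → Legal A →
    Σ (List ℚ) λ σ → ValidInput σ × Σ ℚ λ o → IsOPT n σ o × (0ℚ < o) × AtMostRatio n (algValue A σ) o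
theorem28 zero    ()
theorem28 (suc m) _ A legal = Adversary.outcome A legal
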